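{- Let $f(n,k)={n \brack k}{n+k \brack k}$. Then for all integers $n,i,k\ge 0$, \[ f(n,i)\,f(n,k)=\sum_{j\ge 0} q^{(n-j)(k+i-j)}\,{i+k \brack i}{j \brack j-i,\;j-k,\;i+k-j}\, f(n,j). \]
   Context: $q$ is an indeterminate, $(q)_0=1$ and $(q)_m=(1-q)(1-q^2)\cdots(1-q^m)$ for $m\ge 1$. The $q$-binomial coefficient is ${N \brack K}=\frac{(q)_N}{(q)_K(q)_{N-K}}$ if $0\le K\le N$ and $0$ otherwise. The $q$-multinomial coefficient is ${m \brack a,b,c}=\frac{(q)_m}{(q)_a(q)_b(q)_c}$ if $a,b,c\ge 0$ and $a+b+c=m$, and $0$ otherwise. -}

module Defs where

-- All q-binomial / q-multinomial coefficients are
-- quotients of products of (q)_m, each of which has constant term 1 and is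
-- therefore invertible in Z[[q]]; an identity between such rational functions
-- holds in Q(q) iff it holds coefficientwise in Z[[q]].

open import Data.Nat using (ℕ; zero; suc; _≤?_) renaming (_+_ to _+ℕ_; _*_ to _*ℕ_; _∸_ to _∸ℕ_)
open import Data.Integer using (ℤ; +_; -_; _+_; _*_; _-_)
open import Data.List using (List; []; _∷_)
open import Data.Bool using (if_then_else_)
open import Relation.Nullary using (yes; no)
open import Relation.Nullary.Decidable using (⌊_⌋)
open import Relation.Binary.PropositionalEquality using (_≡_)

Series : Set
Series = ℕ → ℤ

Σℤ : ℕ → (ℕ → ℤ) → ℤ
Σℤ zero    f = + 0
Σℤ (suc n) f = Σℤ n f + f n

0s : Series
0s _ = + 0

1s : Series
1s zero    = + 1
1s (suc _) = + 0

_⊕_ : Series → Series → Series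
(f ⊕ g) d = f d + g d

_⊛_ : Series → Series → Series
(f ⊛ g) d = Σℤ (suc d) (λ i → f i * g (d ∸ℕ i))

qpow : ℕ → Series
qpow e d = if ⌊ e Data.Nat.≟ d ⌋ then + 1 else + 0

oneMinusQ^ : ℕ → Series
oneMinusQ^ m d = 1s d - qpow m d

qPoch : ℕ → Series
qPoch zero    = 1s
qPoch (suc m) = qPoch m ⊛ oneMinusQ^ (suc m)

-- list [g_d, g_{d-1}, ..., g_0] of the coefficients of the inverse g of a
-- series f with constant term 1:  g_0 = 1,
-- g_{d} = - Σ_{i=1}^{d} f_i g_{d-i}.
nth : List ℤ → ℕ → ℤ
nth []       _       = + 0
nth (x ∷ xs) zero    = x
nth (x ∷ xs) (suc n) = nth xs n

invList : Series → ℕ → List ℤ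
invList f zero    = + 1 ∷ []
invList f (suc d) =
  let gs = invList f d in
  (- Σℤ (suc d) (λ i → f (suc i) * nth gs i)) ∷ gs

-- multiplicative inverse in Z[[q]] of a series with constant term 1
inv : Series → Series
inv f d = nth (invList f d) 0

qBinom : ℕ → ℕ → Series
qBinom N K with K ≤? N
... | yes _ = qPoch N ⊛ inv (qPoch K ⊛ qPoch (N ∸ℕ K))
... | no  _ = 0s

qMultinom : ℕ → ℤ → ℤ → ℤ → Series
qMultinom m (+ a) (+ b) (+ c) with (a +ℕ b +ℕ c) Data.Nat.≟ m
... | yes _ = qPoch m ⊛ inv (qPoch a ⊛ (qPoch b ⊛ qPoch c))
... | no  _ = 0s
qMultinom m _ _ _ = 0s

fnk : ℕ → ℕ → Series
fnk n k = qBinom n k ⊛ qBinom (n +ℕ k) k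

ΣS : ℕ → (ℕ → Series) → Series
ΣS zero    F = 0s
ΣS (suc N) F = ΣS N F ⊕ F N

_≈S_ : Series → Series → Set
f ≈S g = ∀ d → f d ≡ g d

module Submission where

-- Writing ρ x = 1/(q)_x for x ≥ 0 and 0 for x < 0, all q-binomial and
-- q-multinomial coefficients take the uniform shape (q)_m ρ(a) ρ(b) ρ(c), and
-- q^j (1-q^{j+1})² f(n,j+1) = (q^j - q^n)(1-q^{n+j+1}) f(n,j) (Pochhammer,
-- ClosedForms).  The theorem is proved by induction on i (Linearization): the
-- expansion for i, times q^k (q^i - q^n)(1-q^{n+i+1}), splits term by term
-- into parts whose index the recurrence raises and parts where it stays
-- (Coefficients); the contiguous relation of the coefficients
-- (ContiguousRelation) recombines them into q^{k+i} (1-q^{i+1})² times the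
-- expansion for i + 1, and this factor cancels.

open import Defs

module FiniteSums where
  open import Data.Nat using (ℕ; zero; suc; _+_; _∸_; _≤_; _<_)
  import Data.Nat.Properties as ℕ
  open import Data.Integer as ℤ using (ℤ; +_)
  import Data.Integer.Properties as ℤ
  open import Relation.Binary.PropositionalEquality
  open import Relation.Nullary using (yes; no)
  open import Function using (_∘_)
  open import Data.Integer.Tactic.RingSolver using (solve-∀)
  open ≡-Reasoning

  Σ-cong : ∀ n {f g : ℕ → ℤ} → (∀ i → i < n → f i ≡ g i) → Σℤ n f ≡ Σℤ n g
  Σ-cong zero    f≡g = refl
  Σ-cong (suc n) f≡g =
    cong₂ ℤ._+_ (Σ-cong n λ i i<n → f≡g i (ℕ.m<n⇒m<1+n i<n)) (f≡g n ℕ.≤-refl)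

  Σ-+ : ∀ n (f g : ℕ → ℤ) → Σℤ n (λ i → f i ℤ.+ g i) ≡ Σℤ n f ℤ.+ Σℤ n g
  Σ-+ zero    f g = refl
  Σ-+ (suc n) f g = begin
    Σℤ n (λ i → f i ℤ.+ g i) ℤ.+ (f n ℤ.+ g n)
      ≡⟨ cong (ℤ._+ (f n ℤ.+ g n)) (Σ-+ n f g) ⟩
    Σℤ n f ℤ.+ Σℤ n g ℤ.+ (f n ℤ.+ g n)
      ≡⟨ interchange (Σℤ n f) (Σℤ n g) (f n) (g n) ⟩
    Σℤ n f ℤ.+ f n ℤ.+ (Σℤ n g ℤ.+ g n) ∎
    where
    interchange : ∀ a b c d → a ℤ.+ b ℤ.+ (c ℤ.+ d) ≡ a ℤ.+ c ℤ.+ (b ℤ.+ d)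
    interchange = solve-∀

  Σ-*ˡ : ∀ n c (f : ℕ → ℤ) → Σℤ n (λ i → c ℤ.* f i) ≡ c ℤ.* Σℤ n f
  Σ-*ˡ zero    c f = sym (ℤ.*-zeroʳ c)
  Σ-*ˡ (suc n) c f = begin
    Σℤ n (λ i → c ℤ.* f i) ℤ.+ c ℤ.* f n ≡⟨ cong (ℤ._+ c ℤ.* f n) (Σ-*ˡ n c f) ⟩
    c ℤ.* Σℤ n f ℤ.+ c ℤ.* f n           ≡⟨ ℤ.*-distribˡ-+ c (Σℤ n f) (f n) ⟨
    c ℤ.* (Σℤ n f ℤ.+ f n)               ∎

  Σ-*ʳ : ∀ n c (f : ℕ → ℤ) → Σℤ n (λ i → f i ℤ.* c) ≡ Σℤ n f ℤ.* c
  Σ-*ʳ n c f = begin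
    Σℤ n (λ i → f i ℤ.* c) ≡⟨ Σ-cong n (λ i _ → ℤ.*-comm (f i) c) ⟩
    Σℤ n (λ i → c ℤ.* f i) ≡⟨ Σ-*ˡ n c f ⟩
    c ℤ.* Σℤ n f           ≡⟨ ℤ.*-comm c (Σℤ n f) ⟩
    Σℤ n f ℤ.* c           ∎

  Σ-zero : ∀ n {f : ℕ → ℤ} → (∀ i → i < n → f i ≡ + 0) → Σℤ n f ≡ + 0
  Σ-zero zero    f≡0 = refl
  Σ-zero (suc n) f≡0 =
    cong₂ ℤ._+_ (Σ-zero n λ i i<n → f≡0 i (ℕ.m<n⇒m<1+n i<n)) (f≡0 n ℕ.≤-refl)

  Σ-head : ∀ n (f : ℕ → ℤ) → Σℤ (suc n) f ≡ f 0 ℤ.+ Σℤ n (λ i → f (suc i))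
  Σ-head zero    f = ℤ.+-comm (+ 0) (f 0)
  Σ-head (suc n) f = begin
    Σℤ (suc n) f ℤ.+ f (suc n)
      ≡⟨ cong (ℤ._+ f (suc n)) (Σ-head n f) ⟩
    f 0 ℤ.+ Σℤ n (λ i → f (suc i)) ℤ.+ f (suc n)
      ≡⟨ ℤ.+-assoc (f 0) _ _ ⟩
    f 0 ℤ.+ Σℤ (suc n) (λ i → f (suc i)) ∎

  Σ-single : ∀ n j {f : ℕ → ℤ} → j < n → (∀ i → i < n → i ≢ j → f i ≡ + 0) →
             Σℤ n f ≡ f j
  Σ-single zero    j () _
  Σ-single (suc n) j {f} j<1+n others with j ℕ.≟ n
  ... | yes refl = begin
    Σℤ n f ℤ.+ f n ≡⟨ cong (ℤ._+ f n) (Σ-zero n λ i i<n → others i (ℕ.m<n⇒m<1+n i<n) (ℕ.<⇒≢ i<n)) ⟩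
    + 0 ℤ.+ f n    ≡⟨ ℤ.+-identityˡ (f n) ⟩
    f n            ∎
  ... | no j≢n = begin
    Σℤ n f ℤ.+ f n ≡⟨ cong₂ ℤ._+_ (Σ-single n j j<n λ i i<n → others i (ℕ.m<n⇒m<1+n i<n))
                                  (others n ℕ.≤-refl (j≢n ∘ sym)) ⟩
    f j ℤ.+ + 0    ≡⟨ ℤ.+-identityʳ (f j) ⟩
    f j            ∎
    where
    j<n : j < n
    j<n = ℕ.≤∧≢⇒< (ℕ.≤-pred j<1+n) j≢n

  Σ-reverse : ∀ n (f : ℕ → ℤ) → Σℤ n f ≡ Σℤ n (λ i → f (n ∸ suc i))
  Σ-reverse zero    f = refl
  Σ-reverse (suc n) f = begin
    Σℤ n f ℤ.+ f n                        ≡⟨ cong (ℤ._+ f n) (Σ-reverse n f) ⟩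
    Σℤ n (λ i → f (n ∸ suc i)) ℤ.+ f n    ≡⟨ ℤ.+-comm _ (f n) ⟩
    f n ℤ.+ Σℤ n (λ i → f (n ∸ suc i))    ≡⟨ Σ-head n (λ i → f (n ∸ i)) ⟨
    Σℤ (suc n) (λ i → f (n ∸ i))          ∎

  Σ-triangle : ∀ N (F : ℕ → ℕ → ℤ) →
    Σℤ N (λ i → Σℤ (suc i) (λ l → F l i)) ≡ Σℤ N (λ l → Σℤ (N ∸ l) (λ t → F l (l + t)))
  Σ-triangle zero    F = refl
  Σ-triangle (suc N) F = begin
    Σℤ N (λ i → Σℤ (suc i) (λ l → F l i)) ℤ.+ Σℤ (suc N) (λ l → F l N)
      ≡⟨ cong (ℤ._+ Σℤ (suc N) (λ l → F l N)) (Σ-triangle N F) ⟩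
    Σℤ N row ℤ.+ Σℤ (suc N) (λ l → F l N)
      ≡⟨ cong (ℤ._+ Σℤ (suc N) (λ l → F l N)) lastRowEmpty ⟨
    Σℤ (suc N) row ℤ.+ Σℤ (suc N) (λ l → F l N)
      ≡⟨ Σ-+ (suc N) row (λ l → F l N) ⟨
    Σℤ (suc N) (λ l → row l ℤ.+ F l N)
      ≡⟨ Σ-cong (suc N) (λ l l<1+N → extendRow l (ℕ.≤-pred l<1+N)) ⟩
    Σℤ (suc N) (λ l → Σℤ (suc N ∸ l) (λ t → F l (l + t))) ∎
    where
    row : ℕ → ℤ
    row l = Σℤ (N ∸ l) (λ t → F l (l + t))
    lastRowEmpty : Σℤ (suc N) row ≡ Σℤ N row
    lastRowEmpty = begin
      Σℤ N row ℤ.+ Σℤ (N ∸ N) (λ t → F N (N + t))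
        ≡⟨ cong (λ m → Σℤ N row ℤ.+ Σℤ m (λ t → F N (N + t))) (ℕ.n∸n≡0 N) ⟩
      Σℤ N row ℤ.+ + 0 ≡⟨ ℤ.+-identityʳ _ ⟩
      Σℤ N row ∎
    extendRow : ∀ l → l ≤ N → row l ℤ.+ F l N ≡ Σℤ (suc N ∸ l) (λ t → F l (l + t))
    extendRow l l≤N rewrite ℕ.+-∸-assoc 1 l≤N =
      cong (λ m → row l ℤ.+ F l m) (sym (ℕ.m+[n∸m]≡n l≤N))

module SeriesRing where
  open FiniteSums
  open import Data.Nat using (ℕ; zero; suc; _+_; _∸_; _≤_)
  import Data.Nat.Properties as ℕ
  open import Data.Integer as ℤ using (ℤ; +_; -[1+_])
  import Data.Integer.Properties as ℤ
  open import Data.Product using (_,_; _×_; proj₁; proj₂)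
  open import Data.Vec as Vec using (allFin)
  open import Data.Vec.N-ary using (N-ary; _$ⁿ_)
  open import Data.Maybe using (From-just; from-just)
  import Algebra.Solver.Ring
  open import Data.Maybe using (Maybe; just; nothing)
  open import Algebra.Bundles using (CommutativeRing; RawRing)
  open import Algebra.Structures using (IsCommutativeMonoid)
  open import Algebra.Solver.Ring.AlmostCommutativeRing
    using (AlmostCommutativeRing; fromCommutativeRing; _-Raw-AlmostCommutative⟶_)
  open import Relation.Binary.PropositionalEquality
  open import Relation.Nullary using (yes; no)
  import Relation.Binary.Reasoning.Setoid

  -- Coefficientwise equality of series, wrapped in a record: unlike the
  -- function type _≈S_, the record type determines both series, so Agda can
  -- infer them as implicit arguments of the congruence lemmas below.
  infix 4 _≋_
  record _≋_ (f g : Series) : Set where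
    constructor coeffwise
    field coeff : f ≈S g
  open _≋_ public

  ≋-refl : ∀ {f} → f ≋ f
  ≋-refl = coeffwise λ _ → refl

  ≋-sym : ∀ {f g} → f ≋ g → g ≋ f
  ≋-sym (coeffwise p) = coeffwise λ d → sym (p d)

  ≋-trans : ∀ {f g h} → f ≋ g → g ≋ h → f ≋ h
  ≋-trans (coeffwise p) (coeffwise q) = coeffwise λ d → trans (p d) (q d)

  ≡⇒≋ : ∀ {f g} → f ≡ g → f ≋ g
  ≡⇒≋ refl = ≋-refl

  neg : Series → Series
  neg f d = ℤ.- f d

  ⊕-cong : ∀ {a b c d} → a ≋ b → c ≋ d → a ⊕ c ≋ b ⊕ d
  ⊕-cong (coeffwise p) (coeffwise q) = coeffwise λ e → cong₂ ℤ._+_ (p e) (q e)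

  neg-cong : ∀ {a b} → a ≋ b → neg a ≋ neg b
  neg-cong (coeffwise p) = coeffwise λ e → cong ℤ.-_ (p e)

  ⊛-cong : ∀ {a b c d} → a ≋ b → c ≋ d → a ⊛ c ≋ b ⊛ d
  ⊛-cong (coeffwise p) (coeffwise q) =
    coeffwise λ e → Σ-cong (suc e) λ i _ → cong₂ ℤ._*_ (p i) (q (e ∸ i))

  ⊕-congˡ : ∀ c {a b} → a ≋ b → a ⊕ c ≋ b ⊕ c
  ⊕-congˡ c p = ⊕-cong p (≋-refl {c})

  ⊕-congʳ : ∀ c {a b} → a ≋ b → c ⊕ a ≋ c ⊕ b
  ⊕-congʳ c p = ⊕-cong (≋-refl {c}) p

  ⊛-congˡ : ∀ c {a b} → a ≋ b → a ⊛ c ≋ b ⊛ c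
  ⊛-congˡ c p = ⊛-cong p (≋-refl {c})

  ⊛-congʳ : ∀ c {a b} → a ≋ b → c ⊛ a ≋ c ⊛ b
  ⊛-congʳ c p = ⊛-cong (≋-refl {c}) p

  ⊕-assoc : ∀ a b c → (a ⊕ b) ⊕ c ≋ a ⊕ (b ⊕ c)
  ⊕-assoc a b c = coeffwise λ d → ℤ.+-assoc (a d) (b d) (c d)

  ⊕-comm : ∀ a b → a ⊕ b ≋ b ⊕ a
  ⊕-comm a b = coeffwise λ d → ℤ.+-comm (a d) (b d)

  ⊕-identityˡ : ∀ a → 0s ⊕ a ≋ a
  ⊕-identityˡ a = coeffwise λ d → ℤ.+-identityˡ (a d)

  ⊕-identityʳ : ∀ a → a ⊕ 0s ≋ a
  ⊕-identityʳ a = coeffwise λ d → ℤ.+-identityʳ (a d)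

  ⊕-inverseˡ : ∀ a → neg a ⊕ a ≋ 0s
  ⊕-inverseˡ a = coeffwise λ d → ℤ.+-inverseˡ (a d)

  ⊕-inverseʳ : ∀ a → a ⊕ neg a ≋ 0s
  ⊕-inverseʳ a = coeffwise λ d → ℤ.+-inverseʳ (a d)

  -- The Cauchy product: commutativity reverses the defining sum,
  -- associativity exchanges the order of a double sum over a triangle.

  ⊛-comm : ∀ a b → a ⊛ b ≋ b ⊛ a
  ⊛-comm a b = coeffwise λ d → begin
    Σℤ (suc d) (λ i → a i ℤ.* b (d ∸ i))
      ≡⟨ Σ-reverse (suc d) _ ⟩
    Σℤ (suc d) (λ i → a (d ∸ i) ℤ.* b (d ∸ (d ∸ i)))
      ≡⟨ Σ-cong (suc d) (λ i i≤d → swap d i (ℕ.≤-pred i≤d)) ⟩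
    Σℤ (suc d) (λ i → b i ℤ.* a (d ∸ i)) ∎
    where
    open ≡-Reasoning
    swap : ∀ d i → i ≤ d → a (d ∸ i) ℤ.* b (d ∸ (d ∸ i)) ≡ b i ℤ.* a (d ∸ i)
    swap d i i≤d rewrite ℕ.m∸[m∸n]≡n i≤d = ℤ.*-comm (a (d ∸ i)) (b i)

  ⊛-assoc : ∀ a b c → (a ⊛ b) ⊛ c ≋ a ⊛ (b ⊛ c)
  ⊛-assoc a b c = coeffwise λ d → begin
    Σℤ (suc d) (λ i → Σℤ (suc i) (λ l → a l ℤ.* b (i ∸ l)) ℤ.* c (d ∸ i))
      ≡⟨ Σ-cong (suc d) (λ i _ → sym (Σ-*ʳ (suc i) (c (d ∸ i)) _)) ⟩
    Σℤ (suc d) (λ i → Σℤ (suc i) (λ l → a l ℤ.* b (i ∸ l) ℤ.* c (d ∸ i)))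
      ≡⟨ Σ-triangle (suc d) (λ l i → a l ℤ.* b (i ∸ l) ℤ.* c (d ∸ i)) ⟩
    Σℤ (suc d) (λ l → Σℤ (suc d ∸ l) (λ t → a l ℤ.* b (l + t ∸ l) ℤ.* c (d ∸ (l + t))))
      ≡⟨ Σ-cong (suc d) (λ l l≤d → row d l (ℕ.≤-pred l≤d)) ⟩
    Σℤ (suc d) (λ l → a l ℤ.* Σℤ (suc (d ∸ l)) (λ t → b t ℤ.* c (d ∸ l ∸ t))) ∎
    where
    open ≡-Reasoning
    row : ∀ d l → l ≤ d →
          Σℤ (suc d ∸ l) (λ t → a l ℤ.* b (l + t ∸ l) ℤ.* c (d ∸ (l + t)))
          ≡ a l ℤ.* Σℤ (suc (d ∸ l)) (λ t → b t ℤ.* c (d ∸ l ∸ t))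
    row d l l≤d rewrite ℕ.+-∸-assoc 1 l≤d = begin
      Σℤ (suc (d ∸ l)) (λ t → a l ℤ.* b (l + t ∸ l) ℤ.* c (d ∸ (l + t)))
        ≡⟨ Σ-cong (suc (d ∸ l)) (λ t _ → cong₂ (λ x y → a l ℤ.* b x ℤ.* c y)
                                               (ℕ.m+n∸m≡n l t) (sym (ℕ.∸-+-assoc d l t))) ⟩
      Σℤ (suc (d ∸ l)) (λ t → a l ℤ.* b t ℤ.* c (d ∸ l ∸ t))
        ≡⟨ Σ-cong (suc (d ∸ l)) (λ t _ → ℤ.*-assoc (a l) _ _) ⟩
      Σℤ (suc (d ∸ l)) (λ t → a l ℤ.* (b t ℤ.* c (d ∸ l ∸ t)))
        ≡⟨ Σ-*ˡ (suc (d ∸ l)) (a l) _ ⟩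
      a l ℤ.* Σℤ (suc (d ∸ l)) (λ t → b t ℤ.* c (d ∸ l ∸ t)) ∎

  ⊛-distribʳ : ∀ a b c → (b ⊕ c) ⊛ a ≋ (b ⊛ a) ⊕ (c ⊛ a)
  ⊛-distribʳ a b c = coeffwise λ d →
    trans (Σ-cong (suc d) λ i _ → ℤ.*-distribʳ-+ (a (d ∸ i)) (b i) (c i)) (Σ-+ (suc d) _ _)

  ⊛-distribˡ : ∀ a b c → a ⊛ (b ⊕ c) ≋ (a ⊛ b) ⊕ (a ⊛ c)
  ⊛-distribˡ a b c = ≋-trans (⊛-comm a (b ⊕ c))
    (≋-trans (⊛-distribʳ a b c) (⊕-cong (⊛-comm b a) (⊛-comm c a)))

  ⊛-identityˡ : ∀ a → 1s ⊛ a ≋ a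
  ⊛-identityˡ a = coeffwise λ d → begin
    Σℤ (suc d) (λ i → 1s i ℤ.* a (d ∸ i))  ≡⟨ Σ-head d _ ⟩
    + 1 ℤ.* a d ℤ.+ Σℤ d (λ _ → + 0)        ≡⟨ cong₂ ℤ._+_ (ℤ.*-identityˡ (a d)) (Σ-zero d λ _ _ → refl) ⟩
    a d ℤ.+ + 0                             ≡⟨ ℤ.+-identityʳ (a d) ⟩
    a d                                     ∎
    where open ≡-Reasoning

  ⊛-identityʳ : ∀ a → a ⊛ 1s ≋ a
  ⊛-identityʳ a = ≋-trans (⊛-comm a 1s) (⊛-identityˡ a)

  ⊛-zeroˡ : ∀ a → 0s ⊛ a ≋ 0s
  ⊛-zeroˡ a = coeffwise λ d → Σ-zero (suc d) λ _ _ → refl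

  ⊛-zeroʳ : ∀ a → a ⊛ 0s ≋ 0s
  ⊛-zeroʳ a = ≋-trans (⊛-comm a 0s) (⊛-zeroˡ a)

  ⊛-vanishes : ∀ X {c} → c ≋ 0s → X ⊛ c ≋ 0s
  ⊛-vanishes X c≋0 = ≋-trans (⊛-congʳ X c≋0) (⊛-zeroʳ X)

  multiples-of-zero : ∀ X Y {c} → c ≋ 0s → X ⊛ c ≋ Y ⊛ c
  multiples-of-zero X Y c≋0 = ≋-trans (⊛-vanishes X c≋0) (≋-sym (⊛-vanishes Y c≋0))

  seriesRing : CommutativeRing _ _
  seriesRing = record
    { Carrier = Series ; _≈_ = _≋_ ; _+_ = _⊕_ ; _*_ = _⊛_ ; -_ = neg ; 0# = 0s ; 1# = 1s
    ; isCommutativeRing = record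
      { isRing = record
        { +-isAbelianGroup = record
          { isGroup = record
            { isMonoid = record
              { isSemigroup = record
                { isMagma = record
                  { isEquivalence = record { refl = ≋-refl ; sym = ≋-sym ; trans = ≋-trans }
                  ; ∙-cong = ⊕-cong }
                ; assoc = ⊕-assoc }
              ; identity = ⊕-identityˡ , ⊕-identityʳ }
            ; inverse = ⊕-inverseˡ , ⊕-inverseʳ
            ; ⁻¹-cong = neg-cong }
          ; comm = ⊕-comm }
        ; *-cong = ⊛-cong
        ; *-assoc = ⊛-assoc
        ; *-identity = ⊛-identityˡ , ⊛-identityʳ
        ; distrib = ⊛-distribˡ , ⊛-distribʳ }
      ; *-comm = ⊛-comm }
    }

  ⊛-isCommutativeMonoid : IsCommutativeMonoid _≋_ _⊛_ 1s
  ⊛-isCommutativeMonoid = CommutativeRing.*-isCommutativeMonoid seriesRing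

  private
    -- The constant series c, the image of the integer coefficients of the
    -- ring solver below.  0 and 1 are sent to 0s and 1s themselves, so that
    -- the solver's constants are literally the ones in the definitions.
    atZero : ℤ → Series
    atZero c zero    = c
    atZero c (suc _) = + 0

    constant : ℤ → Series
    constant (+ 0) = 0s
    constant (+ 1) = 1s
    constant c     = atZero c

    constant≋atZero : ∀ c → constant c ≋ atZero c
    constant≋atZero (+ 0)           = coeffwise λ { zero → refl ; (suc d) → refl }
    constant≋atZero (+ 1)           = coeffwise λ { zero → refl ; (suc d) → refl }
    constant≋atZero (+ suc (suc n)) = ≋-refl
    constant≋atZero -[1+ n ]        = ≋-refl

    ℤ-rawRing : RawRing _ _
    ℤ-rawRing = record
      { Carrier = ℤ ; _≈_ = _≡_ ; _+_ = ℤ._+_ ; _*_ = ℤ._*_ ; -_ = ℤ.-_ ; 0# = + 0 ; 1# = + 1 }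

    atZero-* : ∀ a b → atZero a ⊛ atZero b ≋ atZero (a ℤ.* b)
    atZero-* a b = coeffwise λ
      { zero    → ℤ.+-identityˡ (a ℤ.* b)
      ; (suc d) → trans (Σ-head (suc d) _) (cong₂ ℤ._+_ (ℤ.*-zeroʳ a) (Σ-zero (suc d) λ _ _ → refl)) }

    constant-hom : ℤ-rawRing -Raw-AlmostCommutative⟶ fromCommutativeRing seriesRing
    constant-hom = record
      { ⟦_⟧ = constant
      ; +-homo = λ a b → ≋-trans (constant≋atZero (a ℤ.+ b))
                   (≋-sym (≋-trans (⊕-cong (constant≋atZero a) (constant≋atZero b))
                                   (coeffwise λ { zero → refl ; (suc d) → refl })))
      ; *-homo = λ a b → ≋-trans (constant≋atZero (a ℤ.* b))
                   (≋-sym (≋-trans (⊛-cong (constant≋atZero a) (constant≋atZero b)) (atZero-* a b)))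
      ; -‿homo = λ a → ≋-trans (constant≋atZero (ℤ.- a))
                   (≋-sym (≋-trans (neg-cong (constant≋atZero a)) (coeffwise λ { zero → refl ; (suc d) → refl })))
      ; 0-homo = ≋-refl
      ; 1-homo = ≋-refl }

    constant-≟ : ∀ a b → Maybe (constant a ≋ constant b)
    constant-≟ a b with a ℤ.≟ b
    ... | yes refl = just ≋-refl
    ... | no _     = nothing

  -- The ring solver for series, with integer constants 'con c':
  --   ring n (λ x y … → lhs := rhs) (a ∷ b ∷ … ∷ [])
  -- It decides an identity by computing and comparing the normal forms
  -- (integer polynomials) of both sides, so a use never makes Agda compare
  -- two different representations of a series.

  private
    module Ring = Algebra.Solver.Ring ℤ-rawRing (fromCommutativeRing seriesRing) constant-hom constant-≟

    close : ∀ {A : Set} n → N-ary n (Ring.Polynomial n) A → A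
    close n f = f $ⁿ Vec.map Ring.var (allFin n)

    ring-prove : ∀ {n} (e₁ e₂ : Ring.Polynomial n) → Maybe (∀ ρ → Ring.⟦ e₁ ⟧ ρ ≋ Ring.⟦ e₂ ⟧ ρ)
    ring-prove e₁ e₂ with Ring.normalise e₁ Ring.≟N Ring.normalise e₂
    ... | just eq = just λ ρ →
      ≋-trans (≋-sym (Ring.correct e₁ ρ)) (≋-trans (Ring.⟦ eq ⟧N-cong ρ) (Ring.correct e₂ ρ))
    ... | nothing = nothing

  open Ring public using (_:=_; _:+_; _:*_; _:-_; con)

  ring : ∀ n (f : N-ary n (Ring.Polynomial n) (Ring.Polynomial n × Ring.Polynomial n)) →
         From-just (ring-prove (proj₁ (close n f)) (proj₂ (close n f)))
  ring n f = from-just (ring-prove (proj₁ (close n f)) (proj₂ (close n f)))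

  module ≋-Reasoning = Relation.Binary.Reasoning.Setoid (CommutativeRing.setoid seriesRing)

module Monomials where
  open FiniteSums
  open SeriesRing
  open import Data.Nat using (ℕ; zero; suc; _+_; _∸_; _<_; s≤s)
  import Data.Nat.Properties as ℕ
  open import Data.Integer as ℤ using (+_)
  import Data.Integer.Properties as ℤ
  open import Data.Empty using (⊥-elim)
  open import Function using (_∘_)
  open import Relation.Binary.PropositionalEquality
  open import Relation.Nullary using (yes; no)

  qpow-at-e : ∀ e → qpow e e ≡ + 1
  qpow-at-e e with e ℕ.≟ e
  ... | yes _   = refl
  ... | no e≢e = ⊥-elim (e≢e refl)

  qpow-off-e : ∀ e d → e ≢ d → qpow e d ≡ + 0
  qpow-off-e e d e≢d with e ℕ.≟ d
  ... | yes e≡d = ⊥-elim (e≢d e≡d)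
  ... | no _    = refl

  qpow-shift : ∀ e g d → (qpow e ⊛ g) (e + d) ≡ g d
  qpow-shift e g d = begin
    (qpow e ⊛ g) (e + d)          ≡⟨ Σ-single (suc (e + d)) e (s≤s (ℕ.m≤m+n e d)) others ⟩
    qpow e e ℤ.* g (e + d ∸ e)    ≡⟨ cong₂ ℤ._*_ (qpow-at-e e) (cong g (ℕ.m+n∸m≡n e d)) ⟩
    + 1 ℤ.* g d                   ≡⟨ ℤ.*-identityˡ (g d) ⟩
    g d                           ∎
    where
    open ≡-Reasoning
    others : ∀ i → i < suc (e + d) → i ≢ e → qpow e i ℤ.* g (e + d ∸ i) ≡ + 0
    others i _ i≢e = cong (ℤ._* g (e + d ∸ i)) (qpow-off-e e i (i≢e ∘ sym))

  qpow-below : ∀ e g d → d < e → (qpow e ⊛ g) d ≡ + 0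
  qpow-below e g d d<e = Σ-zero (suc d) λ i i≤d →
    cong (ℤ._* g (d ∸ i)) (qpow-off-e e i λ e≡i → ℕ.<-irrefl (sym e≡i) (ℕ.≤-<-trans (ℕ.≤-pred i≤d) d<e))

  qpow-cancel : ∀ e {f g} → qpow e ⊛ f ≋ qpow e ⊛ g → f ≋ g
  qpow-cancel e {f} {g} (coeffwise p) = coeffwise λ d →
    trans (sym (qpow-shift e f d)) (trans (p (e + d)) (qpow-shift e g d))

  qpow-0 : qpow 0 ≋ 1s
  qpow-0 = coeffwise λ { zero → refl ; (suc d) → refl }

  qpow-+ : ∀ a b → qpow (a + b) ≋ qpow a ⊛ qpow b
  qpow-+ a b = coeffwise coefficient
    where
    coefficient : ∀ d → qpow (a + b) d ≡ (qpow a ⊛ qpow b) d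
    coefficient d with a ℕ.≤? d
    ... | no a≰d = trans (qpow-off-e (a + b) d λ a+b≡d → a≰d (ℕ.m+n≤o⇒m≤o a (ℕ.≤-reflexive a+b≡d)))
                         (sym (qpow-below a (qpow b) d (ℕ.≰⇒> a≰d)))
    ... | yes a≤d = begin
      qpow (a + b) d                ≡⟨ cong (qpow (a + b)) (ℕ.m+[n∸m]≡n a≤d) ⟨
      qpow (a + b) (a + (d ∸ a))    ≡⟨ shifted (d ∸ a) ⟩
      qpow b (d ∸ a)                ≡⟨ qpow-shift a (qpow b) (d ∸ a) ⟨
      (qpow a ⊛ qpow b) (a + (d ∸ a)) ≡⟨ cong (qpow a ⊛ qpow b) (ℕ.m+[n∸m]≡n a≤d) ⟩
      (qpow a ⊛ qpow b) d           ∎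
      where
      open ≡-Reasoning
      shifted : ∀ t → qpow (a + b) (a + t) ≡ qpow b t
      shifted t with b ℕ.≟ t
      ... | yes refl = qpow-at-e (a + b)
      ... | no b≢t   = qpow-off-e (a + b) (a + t) (b≢t ∘ ℕ.+-cancelˡ-≡ a b t)

  qpow-cong : ∀ {a b} → a ≡ b → qpow a ≋ qpow b
  qpow-cong refl = ≋-refl

  qpow-1+ : ∀ m p → qpow (suc (m + p)) ≋ qpow 1 ⊛ (qpow m ⊛ qpow p)
  qpow-1+ m p = ≋-trans (qpow-+ 1 (m + p)) (⊛-congʳ (qpow 1) (qpow-+ m p))

  qpow-merge : ∀ a b c e → a + (b + c) ≡ e → qpow a ⊛ (qpow b ⊛ qpow c) ≋ qpow e
  qpow-merge a b c _ refl = ≋-sym (≋-trans (qpow-+ a (b + c)) (⊛-congʳ (qpow a) (qpow-+ b c)))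

module Units where
  open FiniteSums
  open SeriesRing
  open import Data.Nat using (ℕ; zero; suc; _∸_; _≤_; s≤s)
  import Data.Nat.Properties as ℕ
  open import Data.Integer as ℤ using (+_)
  import Data.Integer.Properties as ℤ
  open import Relation.Binary.PropositionalEquality
  open import Data.Vec using (_∷_; [])

  -- Series with constant term 1 are units; 'inv' computes their inverse.
  -- (A record, so that the series can be inferred from a proof.)
  record Unit (f : Series) : Set where
    constructor constant-term
    field constant-term-is-1 : f 0 ≡ + 1

  unit-⊛ : ∀ {f g} → Unit f → Unit g → Unit (f ⊛ g)
  unit-⊛ {f} {g} (constant-term f₀) (constant-term g₀) =
    constant-term (trans (ℤ.+-identityˡ (f 0 ℤ.* g 0)) (cong₂ ℤ._*_ f₀ g₀))

  invList-nth : ∀ f d i → i ≤ d → nth (invList f d) i ≡ inv f (d ∸ i)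
  invList-nth f d       zero    _         = refl
  invList-nth f (suc d) (suc i) (s≤s i≤d) = invList-nth f d i i≤d

  inv-suc : ∀ f d → inv f (suc d) ≡ ℤ.- Σℤ (suc d) (λ i → f (suc i) ℤ.* inv f (d ∸ i))
  inv-suc f d = cong ℤ.-_ (Σ-cong (suc d) λ i i≤d → cong (f (suc i) ℤ.*_) (invList-nth f d i (ℕ.≤-pred i≤d)))

  inverseʳ : ∀ f → Unit f → f ⊛ inv f ≋ 1s
  inverseʳ f (constant-term f₀) = coeffwise coefficient
    where
    open ≡-Reasoning
    coefficient : ∀ d → (f ⊛ inv f) d ≡ 1s d
    coefficient zero    = trans (ℤ.+-identityˡ _) (cong (ℤ._* + 1) f₀)
    coefficient (suc d) = begin
      Σℤ (suc (suc d)) (λ i → f i ℤ.* inv f (suc d ∸ i)) ≡⟨ Σ-head (suc d) _ ⟩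
      f 0 ℤ.* inv f (suc d) ℤ.+ S                         ≡⟨ cong₂ (λ x y → x ℤ.* y ℤ.+ S) f₀ (inv-suc f d) ⟩
      + 1 ℤ.* ℤ.- S ℤ.+ S                                 ≡⟨ cong (ℤ._+ S) (ℤ.*-identityˡ (ℤ.- S)) ⟩
      ℤ.- S ℤ.+ S                                         ≡⟨ ℤ.+-inverseˡ S ⟩
      + 0                                                 ∎
      where S = Σℤ (suc d) (λ i → f (suc i) ℤ.* inv f (d ∸ i))

  unit-cancel : ∀ u {f g} → Unit u → u ⊛ f ≋ u ⊛ g → f ≋ g
  unit-cancel u {f} {g} u₀ uf≋ug = begin
    f                  ≈⟨ cancel f ⟨
    inv u ⊛ (u ⊛ f)    ≈⟨ ⊛-congʳ (inv u) uf≋ug ⟩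
    inv u ⊛ (u ⊛ g)    ≈⟨ cancel g ⟩
    g                  ∎
    where
    open ≋-Reasoning
    cancel : ∀ h → inv u ⊛ (u ⊛ h) ≋ h
    cancel h = begin
      inv u ⊛ (u ⊛ h)    ≈⟨ ring 3 (λ u u⁻¹ h → u⁻¹ :* (u :* h) := (u :* u⁻¹) :* h)
                                   (u ∷ inv u ∷ h ∷ []) ⟩
      (u ⊛ inv u) ⊛ h    ≈⟨ ⊛-congˡ h (inverseʳ u u₀) ⟩
      1s ⊛ h             ≈⟨ ⊛-identityˡ h ⟩
      h                  ∎

  inverse-⊛ : ∀ {f g} → Unit f → Unit g → inv (f ⊛ g) ≋ inv f ⊛ inv g
  inverse-⊛ {f} {g} f₀ g₀ = unit-cancel (f ⊛ g) (unit-⊛ f₀ g₀) (begin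
    (f ⊛ g) ⊛ inv (f ⊛ g)        ≈⟨ inverseʳ (f ⊛ g) (unit-⊛ f₀ g₀) ⟩
    1s                           ≈⟨ ⊛-identityˡ 1s ⟨
    1s ⊛ 1s                      ≈⟨ ⊛-cong (inverseʳ f f₀) (inverseʳ g g₀) ⟨
    (f ⊛ inv f) ⊛ (g ⊛ inv g)
      ≈⟨ ring 4 (λ f g f⁻¹ g⁻¹ → (f :* f⁻¹) :* (g :* g⁻¹) := (f :* g) :* (f⁻¹ :* g⁻¹))
                (f ∷ g ∷ inv f ∷ inv g ∷ []) ⟩
    (f ⊛ g) ⊛ (inv f ⊛ inv g)    ∎)
    where open ≋-Reasoning

module Pochhammer where
  open SeriesRing
  open Monomials
  open Units
  open import Data.Nat using (ℕ; zero; suc; _+_; _∸_; _<_)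
  import Data.Nat.Properties as ℕ
  open import Data.Integer as ℤ using (ℤ; +_; -[1+_]; _-_)
  import Data.Integer.Properties as ℤ
  open import Data.Integer.Tactic.RingSolver using (solve-∀)
  open import Data.Vec using (_∷_; [])
  open import Relation.Binary.PropositionalEquality

  ω : ℕ → Series
  ω = oneMinusQ^

  ω-via : ∀ m {X} → qpow m ≋ X → ω m ≋ 1s ⊕ neg X
  ω-via m q^m≋X = ⊕-congʳ 1s (neg-cong q^m≋X)

  ω-cong : ∀ {a b} → a ≡ b → ω a ≋ ω b
  ω-cong refl = ≋-refl

  ω-0 : ω 0 ≋ 0s
  ω-0 = ≋-trans (ω-via 0 qpow-0) (⊕-inverseʳ 1s)

  exponent-irrelevant : ∀ S x y Z → (∀ s → S ≡ suc s → x ≡ y) → qpow x ⊛ (ω S ⊛ Z) ≋ qpow y ⊛ (ω S ⊛ Z)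
  exponent-irrelevant zero    x y Z _   = multiples-of-zero (qpow x) (qpow y) (≋-trans (⊛-congˡ Z ω-0) (⊛-zeroˡ Z))
  exponent-irrelevant (suc s) x y Z x≡y = ⊛-congˡ (ω (suc s) ⊛ Z) (qpow-cong (x≡y s refl))

  qPoch-unit : ∀ m → Unit (qPoch m)
  qPoch-unit zero    = constant-term refl
  qPoch-unit (suc m) = unit-⊛ {qPoch m} {ω (suc m)} (qPoch-unit m) (constant-term refl)

  -- ρ x = 1/(q)_x for x ≥ 0 and ρ x = 0 for x < 0.  With this convention a
  -- q-multinomial coefficient is (q)_m ρ(a) ρ(b) ρ(c) for all integers with
  -- a + b + c = m, and 1/(q)_{d-1} = (1 - q^d)/(q)_d holds for all d ≥ 0.
  ρ : ℤ → Series
  ρ (+ m)    = inv (qPoch m)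
  ρ -[1+ _ ] = 0s

  ρ-cong : ∀ {x y} → x ≡ y → ρ x ≋ ρ y
  ρ-cong refl = ≋-refl

  ρ-inverse : ∀ m → qPoch m ⊛ ρ (+ m) ≋ 1s
  ρ-inverse m = inverseʳ (qPoch m) (qPoch-unit m)

  ρ-0 : ρ (+ 0) ≋ 1s
  ρ-0 = ≋-trans (≋-sym (⊛-identityˡ (ρ (+ 0)))) (ρ-inverse 0)

  ρ-step : ∀ m → ρ (+ m) ≋ ω (suc m) ⊛ ρ (+ suc m)
  ρ-step m = begin
    ρ (+ m)                                            ≈⟨ ⊛-identityʳ (ρ (+ m)) ⟨
    ρ (+ m) ⊛ 1s                                       ≈⟨ ⊛-congʳ (ρ (+ m)) (ρ-inverse (suc m)) ⟨
    ρ (+ m) ⊛ ((qPoch m ⊛ ω (suc m)) ⊛ ρ (+ suc m))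
      ≈⟨ ring 4 (λ r p w r′ → r :* ((p :* w) :* r′) := (p :* r) :* (w :* r′))
                (ρ (+ m) ∷ qPoch m ∷ ω (suc m) ∷ ρ (+ suc m) ∷ []) ⟩
    (qPoch m ⊛ ρ (+ m)) ⊛ (ω (suc m) ⊛ ρ (+ suc m))    ≈⟨ ⊛-congˡ (ω (suc m) ⊛ ρ (+ suc m)) (ρ-inverse m) ⟩
    1s ⊛ (ω (suc m) ⊛ ρ (+ suc m))                     ≈⟨ ⊛-identityˡ (ω (suc m) ⊛ ρ (+ suc m)) ⟩
    ω (suc m) ⊛ ρ (+ suc m)                            ∎
    where open ≋-Reasoning

  ρ-pred : ∀ d → ρ (+ d - + 1) ≋ ω d ⊛ ρ (+ d)
  ρ-pred zero    = ≋-sym (≋-trans (⊛-congˡ (ρ (+ 0)) ω-0) (⊛-zeroˡ (ρ (+ 0))))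
  ρ-pred (suc d) = ρ-step d

  sub-exact : ∀ {m d n} → m + d ≡ n → + n - + m ≡ + d
  sub-exact {m} {d} refl = begin
    + (m + d) - + m    ≡⟨ ℤ.m-n≡m⊖n (m + d) m ⟩
    (m + d) ℤ.⊖ m      ≡⟨ ℤ.⊖-≥ (ℕ.m≤m+n m d) ⟩
    + (m + d ∸ m)      ≡⟨ cong +_ (ℕ.m+n∸m≡n m d) ⟩
    + d                ∎
    where open ≡-Reasoning

  sub-pred : ∀ {m d n} → m + d ≡ suc n → + n - + m ≡ + d - + 1
  sub-pred {m} {d} {n} m+d≡1+n = begin
    + n - + m                    ≡⟨ shift (+ n) (+ m) ⟩
    (+ 1 ℤ.+ + n) - + m - + 1    ≡⟨ cong (_- + 1) (sub-exact {m} {d} m+d≡1+n) ⟩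
    + d - + 1                    ∎
    where
    open ≡-Reasoning
    shift : ∀ a b → a - b ≡ (+ 1 ℤ.+ a) - b - + 1
    shift = solve-∀

  sub-negative : ∀ {m n} → n < m → + n - + m ≡ -[1+ (m ∸ suc n) ]
  sub-negative {m} {n} n<m = begin
    + n - + m             ≡⟨ ℤ.m-n≡m⊖n n m ⟩
    n ℤ.⊖ m               ≡⟨ ℤ.⊖-< n<m ⟩
    ℤ.- + (m ∸ n)         ≡⟨ cong (λ k → ℤ.- + k) (ℕ.+-∸-assoc 1 n<m) ⟩
    -[1+ (m ∸ suc n) ]    ∎
    where open ≡-Reasoning

  ρ-sub : ∀ m d {n} → m + d ≡ n → ρ (+ n - + m) ≋ ρ (+ d)
  ρ-sub m d m+d≡n = ρ-cong (sub-exact {m} {d} m+d≡n)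

  ρ-sub-pred : ∀ m d {n} → m + d ≡ suc n → ρ (+ n - + m) ≋ ω d ⊛ ρ (+ d)
  ρ-sub-pred m d m+d≡1+n = ≋-trans (ρ-cong (sub-pred {m} {d} m+d≡1+n)) (ρ-pred d)

  ρ-sub-negative : ∀ {m n} → n < m → ρ (+ n - + m) ≋ 0s
  ρ-sub-negative {m} {n} n<m = ρ-cong (sub-negative {m} {n} n<m)

module ClosedForms where
  open SeriesRing
  open Monomials
  open Units
  open Pochhammer
  open import Data.Nat using (ℕ; suc; _+_; _∸_; _<_)
  import Data.Nat.Properties as ℕ
  open import Data.Integer as ℤ using (ℤ; +_; -[1+_]; _-_)
  import Data.Integer.Properties as ℤ
  open import Data.Integer.Tactic.RingSolver using (solve-∀)
  open import Data.Empty using (⊥-elim)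
  open import Relation.Binary.PropositionalEquality
  open import Data.Vec using (_∷_; [])
  open import Relation.Nullary using (yes; no)

  -- Closed forms of the q-binomial and q-multinomial coefficients and of
  -- f(n,k) in terms of (q)_m and ρ, valid for all arguments: the cases in
  -- which the definitions in Defs return 0 are exactly those in which some
  -- argument of ρ is negative.

  private
    vanishes : ∀ x y {z} → z ≋ 0s → x ⊛ (y ⊛ z) ≋ 0s
    vanishes x y z≋0 = ≋-trans (⊛-congʳ x (≋-trans (⊛-congʳ y z≋0) (⊛-zeroʳ y))) (⊛-zeroʳ x)

  qBinom-closed : ∀ N K → qBinom N K ≋ qPoch N ⊛ (ρ (+ K) ⊛ ρ (+ N - + K))
  qBinom-closed N K with K ℕ.≤? N
  ... | yes K≤N = ⊛-congʳ (qPoch N) (≋-trans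
          (inverse-⊛ {qPoch K} {qPoch (N ∸ K)} (qPoch-unit K) (qPoch-unit (N ∸ K)))
          (⊛-congʳ (ρ (+ K)) (≋-sym (ρ-sub K (N ∸ K) (ℕ.m+[n∸m]≡n K≤N)))))
  ... | no K≰N = ≋-sym (vanishes (qPoch N) (ρ (+ K)) (ρ-sub-negative (ℕ.≰⇒> K≰N)))

  qMultinom-closed : ∀ m x y z → x ℤ.+ y ℤ.+ z ≡ + m →
    qMultinom m x y z ≋ qPoch m ⊛ (ρ x ⊛ (ρ y ⊛ ρ z))
  qMultinom-closed m (+ a) (+ b) (+ c) sum≡m with (a + b + c) ℕ.≟ m
  ... | yes _ = ⊛-congʳ (qPoch m) (≋-trans
          (inverse-⊛ {qPoch a} {qPoch b ⊛ qPoch c} (qPoch-unit a) (unit-⊛ {qPoch b} {qPoch c} (qPoch-unit b) (qPoch-unit c)))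
          (⊛-congʳ (ρ (+ a)) (inverse-⊛ {qPoch b} {qPoch c} (qPoch-unit b) (qPoch-unit c))))
  ... | no sum≢m = ⊥-elim (sum≢m (ℤ.+-injective sum≡m))
  qMultinom-closed m (+ a) (+ b) -[1+ c ] _ = ≋-sym (vanishes (qPoch m) (ρ (+ a)) (⊛-zeroʳ (ρ (+ b))))
  qMultinom-closed m (+ a) -[1+ b ] z     _ = ≋-sym (vanishes (qPoch m) (ρ (+ a)) (⊛-zeroˡ (ρ z)))
  qMultinom-closed m -[1+ a ] y z         _ = ≋-sym (≋-trans (⊛-congʳ (qPoch m) (⊛-zeroˡ (ρ y ⊛ ρ z))) (⊛-zeroʳ (qPoch m)))

  Mult : ℕ → ℕ → ℕ → Series
  Mult i k j = qMultinom j (+ j - + i) (+ j - + k) (+ (i + k) - + j)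

  Mult-closed : ∀ i k j → Mult i k j ≋ qPoch j ⊛ (ρ (+ j - + i) ⊛ (ρ (+ j - + k) ⊛ ρ (+ (i + k) - + j)))
  Mult-closed i k j = qMultinom-closed j (+ j - + i) (+ j - + k) (+ (i + k) - + j) (sum (+ i) (+ k) (+ j))
    where
    sum : ∀ i k j → (j - i) ℤ.+ (j - k) ℤ.+ ((i ℤ.+ k) - j) ≡ j
    sum = solve-∀

  binomial-closed : ∀ i k → qBinom (i + k) i ≋ qPoch (i + k) ⊛ (ρ (+ i) ⊛ ρ (+ k))
  binomial-closed i k = ≋-trans (qBinom-closed (i + k) i) (⊛-congʳ (qPoch (i + k)) (⊛-congʳ (ρ (+ i)) (ρ-sub i k refl)))

  binomial-shift : ∀ i k → ω (suc i) ⊛ qBinom (suc i + k) (suc i) ≋ ω (suc (i + k)) ⊛ qBinom (i + k) i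
  binomial-shift i k = begin
    ω (suc i) ⊛ qBinom (suc i + k) (suc i)
      ≈⟨ ⊛-congʳ (ω (suc i)) (binomial-closed (suc i) k) ⟩
    ω (suc i) ⊛ ((qPoch (i + k) ⊛ ω (suc (i + k))) ⊛ (ρ (+ suc i) ⊛ ρ (+ k)))
      ≈⟨ ring 5 (λ w p w′ r r′ → w :* ((p :* w′) :* (r :* r′)) := w′ :* (p :* ((w :* r) :* r′)))
              (ω (suc i) ∷ qPoch (i + k) ∷ ω (suc (i + k)) ∷ ρ (+ suc i) ∷ ρ (+ k) ∷ []) ⟩
    ω (suc (i + k)) ⊛ (qPoch (i + k) ⊛ ((ω (suc i) ⊛ ρ (+ suc i)) ⊛ ρ (+ k)))
      ≈⟨ ⊛-congʳ (ω (suc (i + k))) (⊛-congʳ (qPoch (i + k)) (⊛-congˡ (ρ (+ k)) (ρ-step i))) ⟨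
    ω (suc (i + k)) ⊛ (qPoch (i + k) ⊛ (ρ (+ i) ⊛ ρ (+ k)))
      ≈⟨ ⊛-congʳ (ω (suc (i + k))) (binomial-closed i k) ⟨
    ω (suc (i + k)) ⊛ qBinom (i + k) i ∎
    where open ≋-Reasoning

  fnk-closed : ∀ n j → fnk n j ≋ qPoch (n + j) ⊛ (ρ (+ j) ⊛ (ρ (+ j) ⊛ ρ (+ n - + j)))
  fnk-closed n j = begin
    qBinom n j ⊛ qBinom (n + j) j
      ≈⟨ ⊛-cong (qBinom-closed n j) (≋-trans (qBinom-closed (n + j) j)
                   (⊛-congʳ (qPoch (n + j)) (⊛-congʳ (ρ (+ j)) (ρ-sub j n (ℕ.+-comm j n))))) ⟩
    (qPoch n ⊛ (ρ (+ j) ⊛ ρ (+ n - + j))) ⊛ (qPoch (n + j) ⊛ (ρ (+ j) ⊛ ρ (+ n)))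
      ≈⟨ ring 5 (λ p r s p′ r′ → (p :* (r :* s)) :* (p′ :* (r :* r′)) := (p :* r′) :* (p′ :* (r :* (r :* s))))
              (qPoch n ∷ ρ (+ j) ∷ ρ (+ n - + j) ∷ qPoch (n + j) ∷ ρ (+ n) ∷ []) ⟩
    (qPoch n ⊛ ρ (+ n)) ⊛ (qPoch (n + j) ⊛ (ρ (+ j) ⊛ (ρ (+ j) ⊛ ρ (+ n - + j))))
      ≈⟨ ⊛-congˡ (qPoch (n + j) ⊛ (ρ (+ j) ⊛ (ρ (+ j) ⊛ ρ (+ n - + j)))) (ρ-inverse n) ⟩
    1s ⊛ (qPoch (n + j) ⊛ (ρ (+ j) ⊛ (ρ (+ j) ⊛ ρ (+ n - + j))))
      ≈⟨ ⊛-identityˡ (qPoch (n + j) ⊛ (ρ (+ j) ⊛ (ρ (+ j) ⊛ ρ (+ n - + j)))) ⟩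
    qPoch (n + j) ⊛ (ρ (+ j) ⊛ (ρ (+ j) ⊛ ρ (+ n - + j))) ∎
    where open ≋-Reasoning

  fnk-vanishes : ∀ {n j} → n < j → fnk n j ≋ 0s
  fnk-vanishes {n} {j} n<j = ≋-trans (fnk-closed n j)
    (vanishes (qPoch (n + j)) (ρ (+ j)) (≋-trans (⊛-congʳ (ρ (+ j)) (ρ-sub-negative n<j)) (⊛-zeroʳ (ρ (+ j)))))

  fnk-0 : ∀ n → fnk n 0 ≋ 1s
  fnk-0 n = begin
    fnk n 0                                                ≈⟨ fnk-closed n 0 ⟩
    qPoch (n + 0) ⊛ (ρ (+ 0) ⊛ (ρ (+ 0) ⊛ ρ (+ n - + 0)))  ≈⟨ ⊛-cong (≡⇒≋ (cong qPoch (ℕ.+-identityʳ n)))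
                                                               (⊛-cong ρ-0 (⊛-cong ρ-0 (ρ-sub 0 n refl))) ⟩
    qPoch n ⊛ (1s ⊛ (1s ⊛ ρ (+ n)))                        ≈⟨ ⊛-congʳ (qPoch n) (≋-trans (⊛-identityˡ (1s ⊛ ρ (+ n)))
                                                                                          (⊛-identityˡ (ρ (+ n)))) ⟩
    qPoch n ⊛ ρ (+ n)                                      ≈⟨ ρ-inverse n ⟩
    1s                                                     ∎
    where open ≋-Reasoning

  D : ℕ → Series
  D j = qpow j ⊛ (ω (suc j) ⊛ ω (suc j))

  E : ℕ → ℕ → Series
  E n j = (qpow j ⊕ neg (qpow n)) ⊛ ω (suc (n + j))

  shifted-reciprocal : ∀ n j → qpow j ⊛ ρ (+ n - + suc j) ≋ (qpow j ⊕ neg (qpow n)) ⊛ ρ (+ n - + j)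
  shifted-reciprocal n j with j ℕ.≤? n
  ... | yes j≤n = begin
    qpow j ⊛ ρ (+ n - + suc j)                   ≈⟨ ⊛-congʳ (qpow j) (ρ-sub-pred (suc j) d (cong suc j+d≡n)) ⟩
    qpow j ⊛ (ω d ⊛ ρ (+ d))                     ≈⟨ ring 3 (λ x y r → x :* ((con (+ 1) :- y) :* r) := (x :- x :* y) :* r)
                                                         (qpow j ∷ qpow d ∷ ρ (+ d) ∷ []) ⟩
    (qpow j ⊕ neg (qpow j ⊛ qpow d)) ⊛ ρ (+ d)   ≈⟨ ⊛-cong (⊕-congʳ (qpow j) (neg-cong (≋-trans (≋-sym (qpow-+ j d))
                                                                                               (qpow-cong j+d≡n))))
                                                           (≋-sym (ρ-sub j d j+d≡n)) ⟩
    (qpow j ⊕ neg (qpow n)) ⊛ ρ (+ n - + j)      ∎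
    where
    open ≋-Reasoning
    d : ℕ
    d = n ∸ j
    j+d≡n : j + d ≡ n
    j+d≡n = ℕ.m+[n∸m]≡n j≤n
  ... | no j≰n = ≋-trans (⊛-congʳ (qpow j) (ρ-sub-negative (ℕ.m<n⇒m<1+n n<j)))
                 (≋-trans (⊛-zeroʳ (qpow j)) (≋-sym (≋-trans (⊛-congʳ (qpow j ⊕ neg (qpow n)) (ρ-sub-negative n<j))
                                                             (⊛-zeroʳ (qpow j ⊕ neg (qpow n))))))
    where n<j = ℕ.≰⇒> j≰n

  fnk-recurrence : ∀ n j → D j ⊛ fnk n (suc j) ≋ E n j ⊛ fnk n j
  fnk-recurrence n j = begin
    D j ⊛ fnk n (suc j)
      ≈⟨ ⊛-congʳ (D j) (≋-trans (fnk-closed n (suc j))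
                                 (⊛-congˡ (ρ′ ⊛ (ρ′ ⊛ ρ (+ n - + suc j))) (≡⇒≋ (cong qPoch (ℕ.+-suc n j))))) ⟩
    D j ⊛ ((P ⊛ ω″) ⊛ (ρ′ ⊛ (ρ′ ⊛ ρ (+ n - + suc j))))
      ≈⟨ ring 6 (λ x w w″ p r′ s → (x :* (w :* w)) :* ((p :* w″) :* (r′ :* (r′ :* s)))
                                      := w″ :* (p :* ((w :* r′) :* ((w :* r′) :* (x :* s)))))
                (qpow j ∷ ω′ ∷ ω″ ∷ P ∷ ρ′ ∷ ρ (+ n - + suc j) ∷ []) ⟩
    ω″ ⊛ (P ⊛ ((ω′ ⊛ ρ′) ⊛ ((ω′ ⊛ ρ′) ⊛ (qpow j ⊛ ρ (+ n - + suc j)))))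
      ≈⟨ ⊛-congʳ ω″ (⊛-congʳ P (⊛-cong (≋-sym (ρ-step j))
                                         (⊛-cong (≋-sym (ρ-step j)) (shifted-reciprocal n j)))) ⟩
    ω″ ⊛ (P ⊛ (ρ (+ j) ⊛ (ρ (+ j) ⊛ ((qpow j ⊕ neg (qpow n)) ⊛ ρ (+ n - + j)))))
      ≈⟨ ring 5 (λ w″ p r a s → w″ :* (p :* (r :* (r :* (a :* s)))) := (a :* w″) :* (p :* (r :* (r :* s))))
              (ω″ ∷ P ∷ ρ (+ j) ∷ (qpow j ⊕ neg (qpow n)) ∷ ρ (+ n - + j) ∷ []) ⟩
    E n j ⊛ (P ⊛ (ρ (+ j) ⊛ (ρ (+ j) ⊛ ρ (+ n - + j))))
      ≈⟨ ⊛-congʳ (E n j) (fnk-closed n j) ⟨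
    E n j ⊛ fnk n j ∎
    where
    open ≋-Reasoning
    P ρ′ ω′ ω″ : Series
    P   = qPoch (n + j)
    ρ′  = ρ (+ suc j)
    ω′  = ω (suc j)
    ω″ = ω (suc (n + j))

module Coefficients where
  open SeriesRing
  open Monomials
  open Pochhammer
  open ClosedForms
  open import Data.Nat using (ℕ; suc; _+_; _∸_; _*_; _<_)
  import Data.Nat.Properties as ℕ
  open import Data.Integer using (+_; _-_)
  open import Relation.Binary.PropositionalEquality
  open import Data.Vec using (_∷_; [])
  open import Relation.Nullary using (yes; no)
  open import Data.Nat.Tactic.RingSolver using (solve-∀)

  C : ℕ → ℕ → ℕ → ℕ → Series
  C n i k j = qpow ((n ∸ j) * (k + i ∸ j)) ⊛ (qBinom (i + k) i ⊛ Mult i k j)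

  data Outside (i k j : ℕ) : Set where
    below-i : j < i     → Outside i k j
    below-k : j < k     → Outside i k j
    above   : i + k < j → Outside i k j

  Mult-outside : ∀ {i k j} → Outside i k j → Mult i k j ≋ 0s
  Mult-outside {i} {k} {j} out = ≋-trans (Mult-closed i k j) (⊛-vanishes (qPoch j) (vanishing out))
    where
    ρi ρk ρs : Series
    ρi = ρ (+ j - + i)
    ρk = ρ (+ j - + k)
    ρs = ρ (+ (i + k) - + j)
    vanishing : Outside i k j → ρi ⊛ (ρk ⊛ ρs) ≋ 0s
    vanishing (below-i j<i) = ≋-trans (⊛-congˡ (ρk ⊛ ρs) (ρ-sub-negative j<i)) (⊛-zeroˡ (ρk ⊛ ρs))
    vanishing (below-k j<k) = ⊛-vanishes ρi (≋-trans (⊛-congˡ ρs (ρ-sub-negative j<k)) (⊛-zeroˡ ρs))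
    vanishing (above ik<j)  = ⊛-vanishes ρi (⊛-vanishes ρk (ρ-sub-negative ik<j))

  C-outside : ∀ n i k j → Outside i k j → C n i k j ≋ 0s
  C-outside n i k j out =
    ⊛-vanishes (qpow ((n ∸ j) * (k + i ∸ j))) (⊛-vanishes (qBinom (i + k) i) (Mult-outside out))

  transfer : ∀ n i a b →
    qpow (a + b) ⊛ E n i ≋ (qpow b ⊛ E n (i + a)) ⊕ (qpow (b + n) ⊛ (ω a ⊛ ω (suc (i + (i + a)))))
  transfer n i a b = begin
    qpow (a + b) ⊛ ((x ⊕ neg w) ⊛ ω (suc (n + i)))
      ≈⟨ ⊛-cong (qpow-+ a b) (⊛-congʳ (x ⊕ neg w) (ω-via (suc (n + i)) (qpow-1+ n i))) ⟩
    (y ⊛ z) ⊛ ((x ⊕ neg w) ⊛ (1s ⊕ neg (t ⊛ (w ⊛ x))))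
      ≈⟨ ring 5 (λ x y z w t →
             (y :* z) :* ((x :- w) :* (con (+ 1) :- t :* (w :* x)))
          := z :* ((x :* y :- w) :* (con (+ 1) :- t :* (w :* (x :* y))))
             :+ (z :* w) :* ((con (+ 1) :- y) :* (con (+ 1) :- t :* (x :* (x :* y))))) (x ∷ y ∷ z ∷ w ∷ t ∷ []) ⟩
    (z ⊛ (((x ⊛ y) ⊕ neg w) ⊛ (1s ⊕ neg (t ⊛ (w ⊛ (x ⊛ y))))))
      ⊕ ((z ⊛ w) ⊛ ((1s ⊕ neg y) ⊛ (1s ⊕ neg (t ⊛ (x ⊛ (x ⊛ y))))))
      ≈⟨ ⊕-cong (⊛-congʳ z (⊛-cong (⊕-congˡ (neg w) (qpow-+ i a)) (ω-via (suc (n + (i + a))) q^[1+n+i+a])))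
                (⊛-cong (qpow-+ b n) (⊛-congʳ (ω a) (ω-via (suc (i + (i + a))) q^[1+2i+a]))) ⟨
    (qpow b ⊛ E n (i + a)) ⊕ (qpow (b + n) ⊛ (ω a ⊛ ω (suc (i + (i + a))))) ∎
    where
    open ≋-Reasoning
    x y z w t : Series
    x = qpow i
    y = qpow a
    z = qpow b
    w = qpow n
    t = qpow 1
    q^[1+n+i+a] : qpow (suc (n + (i + a))) ≋ t ⊛ (w ⊛ (x ⊛ y))
    q^[1+n+i+a] = ≋-trans (qpow-1+ n (i + a)) (⊛-congʳ t (⊛-congʳ w (qpow-+ i a)))
    q^[1+2i+a] : qpow (suc (i + (i + a))) ≋ t ⊛ (x ⊛ (x ⊛ y))
    q^[1+2i+a] = ≋-trans (qpow-1+ i (i + a)) (⊛-congʳ t (⊛-congʳ x (qpow-+ i a)))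

  data Between (i k j : ℕ) : Set where
    outside : Outside i k j → Between i k j
    inside  : ∀ a b → j ≡ i + a → k ≡ a + b → Between i k j

  between : ∀ i k j → Between i k j
  between i k j with j ℕ.<? i | i + k ℕ.<? j
  ... | yes j<i | _        = outside (below-i j<i)
  ... | no  _   | yes ik<j = outside (above ik<j)
  ... | no  j≮i | no ik≮j  = inside (j ∸ i) (i + k ∸ j) j≡i+a (ℕ.+-cancelˡ-≡ i k _ i+k≡i+a+b)
    where
    open ≡-Reasoning
    j≡i+a : j ≡ i + (j ∸ i)
    j≡i+a = sym (ℕ.m+[n∸m]≡n (ℕ.≮⇒≥ j≮i))
    i+k≡i+a+b : i + k ≡ i + ((j ∸ i) + (i + k ∸ j))
    i+k≡i+a+b = begin
      i + k                         ≡⟨ ℕ.m+[n∸m]≡n (ℕ.≮⇒≥ ik≮j) ⟨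
      j + (i + k ∸ j)               ≡⟨ cong (_+ (i + k ∸ j)) j≡i+a ⟩
      i + (j ∸ i) + (i + k ∸ j)     ≡⟨ ℕ.+-assoc i (j ∸ i) (i + k ∸ j) ⟩
      i + ((j ∸ i) + (i + k ∸ j))   ∎

  excess : ∀ i a b → a + b + i ∸ (i + a) ≡ b
  excess i a b = trans (cong (_∸ (i + a)) (reorder i a b)) (ℕ.m+n∸m≡n (i + a) b)
    where
    reorder : ∀ i a b → a + b + i ≡ i + a + b
    reorder = solve-∀

  -- The two parts into which q^k E(n,i) C(n,i,k,j) f(n,j) splits: one in
  -- which j is raised by the recurrence of f, and one in which it stays.
  Raise : ℕ → ℕ → ℕ → ℕ → Series
  Raise n i k j = (qpow (k + i ∸ j) ⊛ D j) ⊛ C n i k j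

  stay-factor : ℕ → ℕ → ℕ → ℕ → Series
  stay-factor n i k j = qpow ((k + i ∸ j) + n) ⊛ (ω (j ∸ i) ⊛ ω (suc (i + j)))

  Stay : ℕ → ℕ → ℕ → ℕ → Series
  Stay n i k j = stay-factor n i k j ⊛ C n i k j

  transfer-C : ∀ n i k j →
    (qpow k ⊛ E n i) ⊛ C n i k j ≋ ((qpow (k + i ∸ j) ⊛ E n j) ⊕ stay-factor n i k j) ⊛ C n i k j
  transfer-C n i k j with between i k j
  ... | outside out = multiples-of-zero (qpow k ⊛ E n i) ((qpow (k + i ∸ j) ⊛ E n j) ⊕ stay-factor n i k j)
                                        (C-outside n i k j out)
  ... | inside a b refl refl = ⊛-congˡ (C n i k j) (≋-trans (transfer n i a b) (⊕-cong
          (⊛-congˡ (E n j) (qpow-cong (sym (excess i a b))))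
          (⊛-cong (qpow-cong (cong (_+ n) (sym (excess i a b))))
                  (⊛-congˡ (ω (suc (i + j))) (ω-cong (sym (ℕ.m+n∸m≡n i a)))))))

  split : ∀ n i k j →
    (qpow k ⊛ E n i) ⊛ (C n i k j ⊛ fnk n j) ≋ (Raise n i k j ⊛ fnk n (suc j)) ⊕ (Stay n i k j ⊛ fnk n j)
  split n i k j = begin
    (qpow k ⊛ E n i) ⊛ (c ⊛ f)
      ≈⟨ ⊛-assoc (qpow k ⊛ E n i) c f ⟨
    ((qpow k ⊛ E n i) ⊛ c) ⊛ f
      ≈⟨ ⊛-congˡ f (transfer-C n i k j) ⟩
    (((x ⊛ E n j) ⊕ w) ⊛ c) ⊛ f
      ≈⟨ ring 5 (λ x e w c f → ((x :* e) :+ w) :* c :* f := (x :* c) :* (e :* f) :+ (w :* c) :* f)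
              (x ∷ E n j ∷ w ∷ c ∷ f ∷ []) ⟩
    ((x ⊛ c) ⊛ (E n j ⊛ f)) ⊕ ((w ⊛ c) ⊛ f)
      ≈⟨ ⊕-congˡ ((w ⊛ c) ⊛ f) (⊛-congʳ (x ⊛ c) (fnk-recurrence n j)) ⟨
    ((x ⊛ c) ⊛ (D j ⊛ fnk n (suc j))) ⊕ ((w ⊛ c) ⊛ f)
      ≈⟨ ⊕-congˡ ((w ⊛ c) ⊛ f) (ring 4 (λ x c d f′ → (x :* c) :* (d :* f′) := ((x :* d) :* c) :* f′)
                                     (x ∷ c ∷ D j ∷ fnk n (suc j) ∷ [])) ⟩
    (Raise n i k j ⊛ fnk n (suc j)) ⊕ (Stay n i k j ⊛ fnk n j) ∎
    where
    open ≋-Reasoning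
    c f x w : Series
    c = C n i k j
    f = fnk n j
    x = qpow (k + i ∸ j)
    w = stay-factor n i k j

module ContiguousRelation where
  open SeriesRing
  open Monomials
  open Pochhammer
  open ClosedForms
  open Coefficients
  open import Data.Nat using (ℕ; zero; suc; _+_; _∸_; _*_; _<_; _≤_; z≤n; s≤s)
  import Data.Nat.Properties as ℕ
  open import Data.Integer using (+_)
  open import Data.Nat.Tactic.RingSolver using (solve-∀)
  open import Data.Vec using (_∷_; [])
  open import Relation.Binary.PropositionalEquality
  open import Relation.Nullary using (yes; no)
  open import Algebra.Bundles using (CommutativeMonoid)
  open import Algebra.Structures using (IsCommutativeMonoid)

  quadratic : ∀ B S J → ω (B + S) ⊛ ω (J + S) ≋ (qpow S ⊛ (ω J ⊛ ω B)) ⊕ (ω (B + S + J) ⊛ ω S)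
  quadratic B S J = begin
    ω (B + S) ⊛ ω (J + S)
      ≈⟨ ⊛-cong (ω-via (B + S) (qpow-+ B S)) (ω-via (J + S) (qpow-+ J S)) ⟩
    (1s ⊕ neg (x ⊛ y)) ⊛ (1s ⊕ neg (u ⊛ y))
      ≈⟨ ring 3 (λ x y u → (con (+ 1) :- x :* y) :* (con (+ 1) :- u :* y)
                            := y :* ((con (+ 1) :- u) :* (con (+ 1) :- x))
                               :+ (con (+ 1) :- (x :* y) :* u) :* (con (+ 1) :- y)) (x ∷ y ∷ u ∷ []) ⟩
    (y ⊛ ((1s ⊕ neg u) ⊛ (1s ⊕ neg x))) ⊕ ((1s ⊕ neg ((x ⊛ y) ⊛ u)) ⊛ (1s ⊕ neg y))
      ≈⟨ ⊕-congʳ (qpow S ⊛ (ω J ⊛ ω B))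
                 (⊛-congˡ (ω S) (ω-via (B + S + J) (≋-trans (qpow-+ (B + S) J) (⊛-congˡ u (qpow-+ B S))))) ⟨
    (qpow S ⊛ (ω J ⊛ ω B)) ⊕ (ω (B + S + J) ⊛ ω S) ∎
    where
    open ≋-Reasoning
    x y u : Series
    x = qpow B
    y = qpow S
    u = qpow J

  -- They are proved in an arbitrary commutative monoid: checking them for
  -- series directly would make Agda unfold the nested Cauchy products.
  module Rearrangements {A : Set} {_≈_ : A → A → Set} {_∙_ : A → A → A} {ε : A}
                        (isCM : IsCommutativeMonoid _≈_ _∙_ ε) where
    private
      monoid : CommutativeMonoid _ _
      monoid = record { isCommutativeMonoid = isCM }
    open import Algebra.Solver.CommutativeMonoid monoid using (solve; _⊜_) renaming (_⊕_ to _·_)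
    open IsCommutativeMonoid isCM using () renaming (refl to ≈-refl)

    gather-next : ∀ x y w z b p r →
      ((x ∙ (y ∙ (w ∙ w))) ∙ (z ∙ (b ∙ (p ∙ r)))) ≈ ((x ∙ (y ∙ z)) ∙ (w ∙ ((w ∙ b) ∙ (p ∙ r))))
    gather-next = solve 7 (λ x y w z b p r →
      (x · (y · (w · w))) · (z · (b · (p · r))) ⊜ (x · (y · z)) · (w · ((w · b) · (p · r)))) ≈-refl

    gather-raise : ∀ s x w z b p w₂ r r′ r″ →
      ((s ∙ (x ∙ (w ∙ w))) ∙ (z ∙ (b ∙ (p ∙ (r ∙ ((w₂ ∙ r′) ∙ r″))))))
      ≈ ((s ∙ (x ∙ z)) ∙ ((w ∙ w₂) ∙ (b ∙ ((p ∙ w) ∙ (r ∙ (r′ ∙ r″))))))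
    gather-raise = solve 10 (λ s x w z b p w₂ r r′ r″ →
      (s · (x · (w · w))) · (z · (b · (p · (r · ((w₂ · r′) · r″)))))
      ⊜ (s · (x · z)) · ((w · w₂) · (b · ((p · w) · (r · (r′ · r″)))))) ≈-refl

    gather-stay : ∀ x w w″ y b p r r′ w₃ r″ →
      ((x ∙ (w ∙ w″)) ∙ (y ∙ (b ∙ (p ∙ (r ∙ (r′ ∙ (w₃ ∙ r″)))))))
      ≈ ((x ∙ y) ∙ (w₃ ∙ (w″ ∙ (b ∙ (p ∙ ((w ∙ r) ∙ (r′ ∙ r″)))))))
    gather-stay = solve 10 (λ x w w″ y b p r r′ w₃ r″ →
      (x · (w · w″)) · (y · (b · (p · (r · (r′ · (w₃ · r″))))))
      ⊜ (x · y) · (w₃ · (w″ · (b · (p · ((w · r) · (r′ · r″))))))) ≈-refl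

  open Rearrangements ⊛-isCommutativeMonoid

  -- The contiguous relation in the range where all three coefficients
  -- involved may be non-zero: j = i + a, k = a + S, n = j + 1 + N and
  -- S + B = i + 1.  Each of the three terms is G W times a polynomial, and
  -- the polynomials are related by the quadratic identity.
  module InRange (i a S N B : ℕ) (S+B≡1+i : S + B ≡ suc i) where

    j k n : ℕ
    j = i + a
    k = a + S
    n = suc j + N

    W : Series
    W = qBinom (i + k) i ⊛ (qPoch (suc j) ⊛ (ρ (+ a) ⊛ (ρ (+ B) ⊛ ρ (+ S))))

    G : Series
    G = qpow (S + j + N * S)

    k+B≡1+j : k + B ≡ suc j
    k+B≡1+j = begin
      a + S + B     ≡⟨ ℕ.+-assoc a S B ⟩
      a + (S + B)   ≡⟨ cong (λ m → a + m) S+B≡1+i ⟩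
      a + suc i     ≡⟨ ℕ.+-suc a i ⟩
      suc (a + i)   ≡⟨ cong suc (ℕ.+-comm a i) ⟩
      suc (i + a)   ∎
      where open ≡-Reasoning

    j+S≡i+k : j + S ≡ i + k
    j+S≡i+k = ℕ.+-assoc i a S

    next-form : (qpow k ⊛ D i) ⊛ C n (suc i) k (suc j) ≋ G ⊛ ((ω (suc i) ⊛ ω (suc (i + k))) ⊛ W)
    next-form = begin
      (qpow k ⊛ D i) ⊛ (qpow ((n ∸ suc j) * (k + suc i ∸ suc j)) ⊛ (b′ ⊛ Mult (suc i) k (suc j)))
        ≈⟨ ⊛-congʳ (qpow k ⊛ D i) (⊛-cong (qpow-cong exponent) (⊛-congʳ b′ multinomial)) ⟩
      (qpow k ⊛ (qpow i ⊛ (ω₁ ⊛ ω₁))) ⊛ (qpow (N * S) ⊛ (b′ ⊛ (P ⊛ R)))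
        ≈⟨ gather-next (qpow k) (qpow i) ω₁ (qpow (N * S)) b′ P R ⟩
      (qpow k ⊛ (qpow i ⊛ qpow (N * S))) ⊛ (ω₁ ⊛ ((ω₁ ⊛ b′) ⊛ (P ⊛ R)))
        ≈⟨ ⊛-cong (qpow-merge k i (N * S) (S + j + N * S) total)
                  (⊛-congʳ ω₁ (⊛-congˡ (P ⊛ R) (binomial-shift i k))) ⟩
      G ⊛ (ω₁ ⊛ ((ω₂ ⊛ qBinom (i + k) i) ⊛ (P ⊛ R)))
        ≈⟨ ring 6 (λ g w w′ b p r → g :* (w :* ((w′ :* b) :* (p :* r))) := g :* ((w :* w′) :* (b :* (p :* r))))
                  (G ∷ ω₁ ∷ ω₂ ∷ qBinom (i + k) i ∷ P ∷ R ∷ []) ⟩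
      G ⊛ ((ω₁ ⊛ ω₂) ⊛ W) ∎
      where
      open ≋-Reasoning
      ω₁ ω₂ b′ P R : Series
      ω₁ = ω (suc i)
      ω₂ = ω (suc (i + k))
      b′ = qBinom (suc i + k) (suc i)
      P  = qPoch (suc j)
      R  = ρ (+ a) ⊛ (ρ (+ B) ⊛ ρ (+ S))
      multinomial : Mult (suc i) k (suc j) ≋ P ⊛ R
      multinomial = ≋-trans (Mult-closed (suc i) k (suc j)) (⊛-congʳ P
        (⊛-cong (ρ-sub (suc i) a refl) (⊛-cong (ρ-sub k B k+B≡1+j) (ρ-sub (suc j) S (cong suc j+S≡i+k)))))
      exponent : (n ∸ suc j) * (k + suc i ∸ suc j) ≡ N * S
      exponent = cong₂ _*_ (ℕ.m+n∸m≡n (suc j) N)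
                           (trans (cong (_∸ suc j) (reorder a S i)) (ℕ.m+n∸m≡n (suc j) S))
        where
        reorder : ∀ a S i → a + S + suc i ≡ suc (i + a) + S
        reorder = solve-∀
      total : k + (i + N * S) ≡ S + j + N * S
      total = reorder a S i N
        where
        reorder : ∀ a S i N → a + S + (i + N * S) ≡ S + (i + a) + N * S
        reorder = solve-∀

    raise-form : Raise n i k j ≋ G ⊛ ((qpow S ⊛ (ω (suc j) ⊛ ω B)) ⊛ W)
    raise-form = begin
      (qpow (k + i ∸ j) ⊛ D j) ⊛ (qpow ((n ∸ j) * (k + i ∸ j)) ⊛ (b ⊛ Mult i k j))
        ≈⟨ ⊛-cong (⊛-congˡ (D j) (qpow-cong (excess i a S)))
                  (⊛-cong (qpow-cong exponent) (⊛-congʳ b multinomial)) ⟩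
      (qpow S ⊛ (qpow j ⊛ (ω′ ⊛ ω′))) ⊛ (qpow (suc N * S) ⊛ (b ⊛ (qPoch j ⊛ (ρ (+ a) ⊛ ((ω B ⊛ ρ (+ B)) ⊛ ρ (+ S))))))
        ≈⟨ gather-raise (qpow S) (qpow j) ω′ (qpow (suc N * S)) b (qPoch j) (ω B) (ρ (+ a)) (ρ (+ B)) (ρ (+ S)) ⟩
      (qpow S ⊛ (qpow j ⊛ qpow (suc N * S))) ⊛ ((ω′ ⊛ ω B) ⊛ W)
        ≈⟨ ⊛-congˡ ((ω′ ⊛ ω B) ⊛ W)
                   (≋-trans (qpow-merge S j (suc N * S) (S + j + N * S + S) total) (qpow-+ (S + j + N * S) S)) ⟩
      (G ⊛ qpow S) ⊛ ((ω′ ⊛ ω B) ⊛ W)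
        ≈⟨ ring 4 (λ g s w w′ → (g :* s) :* (w :* w′) := g :* ((s :* w) :* w′))
                  (G ∷ qpow S ∷ ω′ ⊛ ω B ∷ W ∷ []) ⟩
      G ⊛ ((qpow S ⊛ (ω′ ⊛ ω B)) ⊛ W) ∎
      where
      open ≋-Reasoning
      ω′ b : Series
      ω′ = ω (suc j)
      b  = qBinom (i + k) i
      multinomial : Mult i k j ≋ qPoch j ⊛ (ρ (+ a) ⊛ ((ω B ⊛ ρ (+ B)) ⊛ ρ (+ S)))
      multinomial = ≋-trans (Mult-closed i k j) (⊛-congʳ (qPoch j)
        (⊛-cong (ρ-sub i a refl) (⊛-cong (ρ-sub-pred k B k+B≡1+j) (ρ-sub j S j+S≡i+k))))
      exponent : (n ∸ j) * (k + i ∸ j) ≡ suc N * S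
      exponent = cong₂ _*_ (trans (cong (_∸ j) (sym (ℕ.+-suc j N))) (ℕ.m+n∸m≡n j (suc N))) (excess i a S)
      total : S + (j + suc N * S) ≡ S + j + N * S + S
      total = reorder S i a N
        where
        reorder : ∀ S i a N → S + (i + a + suc N * S) ≡ S + (i + a) + N * S + S
        reorder = solve-∀

    stay-form : Stay n i k (suc j) ≋ G ⊛ ((ω (suc (i + suc j)) ⊛ ω S) ⊛ W)
    stay-form = begin
      (qpow e₁ ⊛ (ω (suc j ∸ i) ⊛ ω″)) ⊛ (qpow e₂ ⊛ (b ⊛ Mult i k (suc j)))
        ≈⟨ ⊛-cong (⊛-congʳ (qpow e₁) (⊛-congˡ ω″ (ω-cong 1+j-i≡1+a)))
                  (⊛-congʳ (qpow e₂) (⊛-congʳ b multinomial)) ⟩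
      (qpow e₁ ⊛ (ω (suc a) ⊛ ω″)) ⊛ (qpow e₂ ⊛ (b ⊛ (P ⊛ (ρ (+ suc a) ⊛ (ρ (+ B) ⊛ (ω S ⊛ ρ (+ S)))))))
        ≈⟨ gather-stay (qpow e₁) (ω (suc a)) ω″ (qpow e₂) b P (ρ (+ suc a)) (ρ (+ B)) (ω S) (ρ (+ S)) ⟩
      (qpow e₁ ⊛ qpow e₂) ⊛ (ω S ⊛ (ω″ ⊛ (b ⊛ (P ⊛ ((ω (suc a) ⊛ ρ (+ suc a)) ⊛ (ρ (+ B) ⊛ ρ (+ S)))))))
        ≈⟨ ⊛-congʳ (qpow e₁ ⊛ qpow e₂) (⊛-congʳ (ω S) (⊛-congʳ ω″ absorb)) ⟩
      (qpow e₁ ⊛ qpow e₂) ⊛ (ω S ⊛ (ω″ ⊛ W))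
        ≈⟨ ⊛-congˡ (ω S ⊛ (ω″ ⊛ W)) (qpow-+ e₁ e₂) ⟨
      qpow (e₁ + e₂) ⊛ (ω S ⊛ (ω″ ⊛ W))
        ≈⟨ exponent-irrelevant S (e₁ + e₂) (S + j + N * S) (ω″ ⊛ W) total ⟩
      G ⊛ (ω S ⊛ (ω″ ⊛ W))
        ≈⟨ ring 4 (λ g s w w′ → g :* (s :* (w :* w′)) := g :* ((w :* s) :* w′))
                  (G ∷ ω S ∷ ω″ ∷ W ∷ []) ⟩
      G ⊛ ((ω″ ⊛ ω S) ⊛ W) ∎
      where
      open ≋-Reasoning
      ω″ b P : Series
      ω″ = ω (suc (i + suc j))
      b  = qBinom (i + k) i
      P  = qPoch (suc j)
      e₁ e₂ : ℕ
      e₁ = (k + i ∸ suc j) + n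
      e₂ = (n ∸ suc j) * (k + i ∸ suc j)
      1+j-i≡1+a : suc j ∸ i ≡ suc a
      1+j-i≡1+a = trans (cong (_∸ i) (sym (ℕ.+-suc i a))) (ℕ.m+n∸m≡n i (suc a))
      multinomial : Mult i k (suc j) ≋ P ⊛ (ρ (+ suc a) ⊛ (ρ (+ B) ⊛ (ω S ⊛ ρ (+ S))))
      multinomial = ≋-trans (Mult-closed i k (suc j)) (⊛-congʳ P
        (⊛-cong (ρ-sub i (suc a) (ℕ.+-suc i a)) (⊛-cong (ρ-sub k B k+B≡1+j) (ρ-sub-pred (suc j) S (cong suc j+S≡i+k)))))
      absorb : b ⊛ (P ⊛ ((ω (suc a) ⊛ ρ (+ suc a)) ⊛ (ρ (+ B) ⊛ ρ (+ S)))) ≋ W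
      absorb = ⊛-congʳ b (⊛-congʳ P (⊛-congˡ (ρ (+ B) ⊛ ρ (+ S)) (≋-sym (ρ-step a))))
      -- the exponents agree whenever the factor 1 - q^S does not vanish
      total : ∀ s → S ≡ suc s → e₁ + e₂ ≡ S + j + N * S
      total s refl = trans (cong₂ (λ x y → x + n + y * x) excess′ (ℕ.m+n∸m≡n (suc j) N)) (reorder s i a N)
        where
        excess′ : a + suc s + i ∸ suc j ≡ s
        excess′ = trans (cong (_∸ suc j) (shift a s i)) (ℕ.m+n∸m≡n (suc j) s)
          where
          shift : ∀ a s i → a + suc s + i ≡ suc (i + a) + s
          shift = solve-∀
        reorder : ∀ s i a N → s + (suc (i + a) + N) + N * s ≡ suc s + (i + a) + N * suc s
        reorder = solve-∀

    core : ω (suc i) ⊛ ω (suc (i + k)) ≋ (qpow S ⊛ (ω (suc j) ⊛ ω B)) ⊕ (ω (suc (i + suc j)) ⊛ ω S)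
    core = begin
      ω (suc i) ⊛ ω (suc (i + k))
        ≈⟨ ⊛-cong (ω-cong B+S≡1+i) (ω-cong (cong suc j+S≡i+k)) ⟨
      ω (B + S) ⊛ ω (suc j + S)
        ≈⟨ quadratic B S (suc j) ⟩
      (qpow S ⊛ (ω (suc j) ⊛ ω B)) ⊕ (ω (B + S + suc j) ⊛ ω S)
        ≈⟨ ⊕-congʳ (qpow S ⊛ (ω (suc j) ⊛ ω B)) (⊛-congˡ (ω S) (ω-cong (cong (_+ suc j) B+S≡1+i))) ⟩
      (qpow S ⊛ (ω (suc j) ⊛ ω B)) ⊕ (ω (suc (i + suc j)) ⊛ ω S) ∎
      where
      open ≋-Reasoning
      B+S≡1+i : B + S ≡ suc i
      B+S≡1+i = trans (ℕ.+-comm B S) S+B≡1+i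

    contiguous-in-range : (qpow k ⊛ D i) ⊛ C n (suc i) k (suc j) ≋ Raise n i k j ⊕ Stay n i k (suc j)
    contiguous-in-range = begin
      (qpow k ⊛ D i) ⊛ C n (suc i) k (suc j)
        ≈⟨ next-form ⟩
      G ⊛ ((ω (suc i) ⊛ ω (suc (i + k))) ⊛ W)
        ≈⟨ ⊛-congʳ G (⊛-congˡ W core) ⟩
      G ⊛ (((qpow S ⊛ (ω (suc j) ⊛ ω B)) ⊕ (ω (suc (i + suc j)) ⊛ ω S)) ⊛ W)
        ≈⟨ ring 4 (λ g x y w → g :* ((x :+ y) :* w) := g :* (x :* w) :+ g :* (y :* w))
                (G ∷ qpow S ⊛ (ω (suc j) ⊛ ω B) ∷ ω (suc (i + suc j)) ⊛ ω S ∷ W ∷ []) ⟩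
      (G ⊛ ((qpow S ⊛ (ω (suc j) ⊛ ω B)) ⊛ W)) ⊕ (G ⊛ ((ω (suc (i + suc j)) ⊛ ω S) ⊛ W))
        ≈⟨ ⊕-cong raise-form stay-form ⟨
      Raise n i k j ⊕ Stay n i k (suc j) ∎
      where open ≋-Reasoning

  -- For j ≤ i the factor 1 - q^{j-i} of Stay vanishes.
  Stay-vanishes : ∀ n i k j → j ≤ i → Stay n i k j ≋ 0s
  Stay-vanishes n i k j j≤i =
    ≋-trans (⊛-congˡ (C n i k j) (⊛-vanishes (qpow ((k + i ∸ j) + n)) factor≋0)) (⊛-zeroˡ (C n i k j))
    where
    factor≋0 : ω (j ∸ i) ⊛ ω (suc (i + j)) ≋ 0s
    factor≋0 = ≋-trans (⊛-congˡ (ω (suc (i + j))) (≋-trans (ω-cong (ℕ.m≤n⇒m∸n≡0 j≤i)) ω-0))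
                       (⊛-zeroˡ (ω (suc (i + j))))

  Stay-outside : ∀ n i k j → Outside i k j → Stay n i k j ≋ 0s
  Stay-outside n i k j out = ⊛-vanishes (stay-factor n i k j) (C-outside n i k j out)

  private
    all-vanish : ∀ n i k j → Outside (suc i) k (suc j) → Outside i k j → Stay n i k (suc j) ≋ 0s →
      (qpow k ⊛ D i) ⊛ C n (suc i) k (suc j) ≋ Raise n i k j ⊕ Stay n i k (suc j)
    all-vanish n i k j next-out out stay≋0 =
      ≋-trans (⊛-vanishes (qpow k ⊛ D i) (C-outside n (suc i) k (suc j) next-out))
              (≋-sym (≋-trans (⊕-cong (⊛-vanishes (qpow (k + i ∸ j) ⊛ D j) (C-outside n i k j out)) stay≋0)
                              (⊕-identityˡ 0s)))

    in-range : ∀ n i k j a S N B → j ≡ i + a → k ≡ a + S → n ≡ suc j + N → S + B ≡ suc i →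
      (qpow k ⊛ D i) ⊛ C n (suc i) k (suc j) ≋ Raise n i k j ⊕ Stay n i k (suc j)
    in-range _ i _ _ a S N B refl refl refl S+B≡1+i = InRange.contiguous-in-range i a S N B S+B≡1+i

  contiguous : ∀ n i k j → suc j ≤ n →
    (qpow k ⊛ D i) ⊛ C n (suc i) k (suc j) ≋ Raise n i k j ⊕ Stay n i k (suc j)
  contiguous n i k j 1+j≤n = by-cases (between (suc i) k (suc j))
    where
    by-cases : Between (suc i) k (suc j) →
      (qpow k ⊛ D i) ⊛ C n (suc i) k (suc j) ≋ Raise n i k j ⊕ Stay n i k (suc j)
    by-cases (outside (below-i (s≤s j<i))) =
      all-vanish n i k j (below-i (s≤s j<i)) (below-i j<i) (Stay-vanishes n i k (suc j) j<i)
    by-cases (outside (below-k 1+j<k)) =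
      all-vanish n i k j (below-k 1+j<k) (below-k (ℕ.<-trans (ℕ.n<1+n j) 1+j<k)) (Stay-outside n i k (suc j) (below-k 1+j<k))
    by-cases (outside (above (s≤s i+k<j))) =
      all-vanish n i k j (above (s≤s i+k<j)) (above i+k<j) (Stay-outside n i k (suc j) (above (ℕ.m<n⇒m<1+n i+k<j)))
    by-cases (inside a S 1+j≡1+i+a k≡a+S) with S ℕ.≤? suc i
    ...   | yes S≤1+i = in-range n i k j a S (n ∸ suc j) (suc i ∸ S) (ℕ.suc-injective 1+j≡1+i+a) k≡a+S
                                 (sym (ℕ.m+[n∸m]≡n 1+j≤n)) (ℕ.m+[n∸m]≡n S≤1+i)
    ...   | no S≰1+i =
      all-vanish n i k j (below-k 1+j<k) (below-k (ℕ.<-trans (ℕ.n<1+n j) 1+j<k)) (Stay-outside n i k (suc j) (below-k 1+j<k))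
      where
      1+j<k : suc j < k
      1+j<k = begin-strict
        suc j         ≡⟨ 1+j≡1+i+a ⟩
        suc i + a     ≡⟨ ℕ.+-comm (suc i) a ⟩
        a + suc i     <⟨ ℕ.+-monoʳ-< a (ℕ.≰⇒> S≰1+i) ⟩
        a + S         ≡⟨ k≡a+S ⟨
        k             ∎
        where open ℕ.≤-Reasoning

  Raise′ : ℕ → ℕ → ℕ → ℕ → Series
  Raise′ n i k zero    = 0s
  Raise′ n i k (suc j) = Raise n i k j

  contiguous′ : ∀ n i k j → j ≤ n → (qpow k ⊛ D i) ⊛ C n (suc i) k j ≋ Raise′ n i k j ⊕ Stay n i k j
  contiguous′ n i k zero    _     = ≋-trans (⊛-vanishes (qpow k ⊛ D i) (C-outside n (suc i) k 0 (below-i (s≤s z≤n))))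
    (≋-sym (≋-trans (⊕-identityˡ (Stay n i k 0)) (Stay-vanishes n i k 0 z≤n)))
  contiguous′ n i k (suc j) 1+j≤n = contiguous n i k j 1+j≤n

module SeriesSums where
  open SeriesRing
  open import Data.Nat using (ℕ; zero; suc; _+_; _<_; _≤_)
  import Data.Nat.Properties as ℕ
  open import Relation.Binary.PropositionalEquality using (_≢_; refl; sym)
  open import Data.Vec using (_∷_; [])
  open import Relation.Nullary using (yes; no)

  ΣS-cong : ∀ N {F G : ℕ → Series} → (∀ j → j < N → F j ≋ G j) → ΣS N F ≋ ΣS N G
  ΣS-cong zero    F≋G = ≋-refl
  ΣS-cong (suc N) F≋G = ⊕-cong (ΣS-cong N λ j j<N → F≋G j (ℕ.m<n⇒m<1+n j<N)) (F≋G N ℕ.≤-refl)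

  ΣS-⊕ : ∀ N (F G : ℕ → Series) → ΣS N (λ j → F j ⊕ G j) ≋ ΣS N F ⊕ ΣS N G
  ΣS-⊕ zero    F G = ≋-sym (⊕-identityˡ 0s)
  ΣS-⊕ (suc N) F G = ≋-trans (⊕-congˡ (F N ⊕ G N) (ΣS-⊕ N F G))
    (ring 4 (λ a b c d → (a :+ b) :+ (c :+ d) := (a :+ c) :+ (b :+ d)) (ΣS N F ∷ ΣS N G ∷ F N ∷ G N ∷ []))

  ΣS-⊛ : ∀ N c (F : ℕ → Series) → c ⊛ ΣS N F ≋ ΣS N (λ j → c ⊛ F j)
  ΣS-⊛ zero    c F = ⊛-zeroʳ c
  ΣS-⊛ (suc N) c F = ≋-trans (⊛-distribˡ c (ΣS N F) (F N)) (⊕-congˡ (c ⊛ F N) (ΣS-⊛ N c F))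

  ΣS-zero : ∀ N {F : ℕ → Series} → (∀ j → j < N → F j ≋ 0s) → ΣS N F ≋ 0s
  ΣS-zero zero    F≋0 = ≋-refl
  ΣS-zero (suc N) F≋0 = ≋-trans (⊕-cong (ΣS-zero N λ j j<N → F≋0 j (ℕ.m<n⇒m<1+n j<N)) (F≋0 N ℕ.≤-refl))
                                (⊕-identityˡ 0s)

  ΣS-single : ∀ N j (F : ℕ → Series) → j < N → (∀ l → l < N → l ≢ j → F l ≋ 0s) → ΣS N F ≋ F j
  ΣS-single zero    j F () _
  ΣS-single (suc N) j F j<1+N others with j ℕ.≟ N
  ... | yes refl = ≋-trans (⊕-congˡ (F N) (ΣS-zero N λ l l<N → others l (ℕ.m<n⇒m<1+n l<N) (ℕ.<⇒≢ l<N)))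
                           (⊕-identityˡ (F N))
  ... | no j≢N = ≋-trans (⊕-cong (ΣS-single N j F (ℕ.≤∧≢⇒< (ℕ.≤-pred j<1+N) j≢N)
                                                λ l l<N → others l (ℕ.m<n⇒m<1+n l<N))
                                 (others N ℕ.≤-refl λ N≡j → j≢N (sym N≡j)))
                         (⊕-identityʳ (F j))

  ΣS-extend : ∀ N M (F : ℕ → Series) → (∀ j → N ≤ j → F j ≋ 0s) → ΣS (M + N) F ≋ ΣS N F
  ΣS-extend N zero    F F≋0 = ≋-refl
  ΣS-extend N (suc M) F F≋0 = ≋-trans (⊕-congʳ (ΣS (M + N) F) (F≋0 (M + N) (ℕ.m≤n+m N M)))
                                      (≋-trans (⊕-identityʳ (ΣS (M + N) F)) (ΣS-extend N M F F≋0))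

  ΣS-head : ∀ N (F : ℕ → Series) → ΣS (suc N) F ≋ F 0 ⊕ ΣS N (λ j → F (suc j))
  ΣS-head zero    F = ⊕-comm 0s (F 0)
  ΣS-head (suc N) F =
    ≋-trans (⊕-congˡ (F (suc N)) (ΣS-head N F)) (⊕-assoc (F 0) (ΣS N (λ j → F (suc j))) (F (suc N)))

  ΣS-shift : ∀ N (F : ℕ → Series) → F 0 ≋ 0s → F N ≋ 0s → ΣS N (λ j → F (suc j)) ≋ ΣS N F
  ΣS-shift N F F₀≋0 F_N≋0 = begin
    ΣS N (λ j → F (suc j))          ≈⟨ ⊕-identityˡ (ΣS N (λ j → F (suc j))) ⟨
    0s ⊕ ΣS N (λ j → F (suc j))     ≈⟨ ⊕-congˡ (ΣS N (λ j → F (suc j))) F₀≋0 ⟨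
    F 0 ⊕ ΣS N (λ j → F (suc j))    ≈⟨ ΣS-head N F ⟨
    ΣS N F ⊕ F N                    ≈⟨ ⊕-congʳ (ΣS N F) F_N≋0 ⟩
    ΣS N F ⊕ 0s                     ≈⟨ ⊕-identityʳ (ΣS N F) ⟩
    ΣS N F                          ∎
    where open ≋-Reasoning

module Linearization where
  open SeriesRing
  open Monomials
  open Units
  open Pochhammer
  open ClosedForms
  open Coefficients
  open ContiguousRelation
  open SeriesSums
  open import Data.Nat using (ℕ; zero; suc; _+_; _∸_; _*_; _<_; _≤_; s≤s)
  import Data.Nat.Properties as ℕ
  open import Data.Integer using (+_; _-_)
  open import Data.Vec using (_∷_; [])
  open import Relation.Binary.PropositionalEquality using (_≡_; _≢_; refl; sym; trans; cong)
  open import Relation.Nullary using (Dec; yes; no)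
  open import Relation.Binary.Definitions using (Tri; tri<; tri≈; tri>)
  open import Data.Empty using (⊥-elim)

  -- The expansion of f(n,i) f(n,k), summed over the range j ≤ n where
  -- f(n,j) can be non-zero.
  Expansion : ℕ → ℕ → ℕ → Series
  Expansion n i k = ΣS (suc n) (λ j → C n i k j ⊛ fnk n j)

  -- i = 0: the only non-zero coefficient is C n 0 k k = 1.
  C-diagonal : ∀ n k → C n 0 k k ≋ 1s
  C-diagonal n k = begin
    qpow ((n ∸ k) * (k + 0 ∸ k)) ⊛ (qBinom (0 + k) 0 ⊛ Mult 0 k k)
      ≈⟨ ⊛-cong (≋-trans (qpow-cong exponent) qpow-0) (⊛-cong binomial multinomial) ⟩
    1s ⊛ (1s ⊛ 1s)
      ≈⟨ ≋-trans (⊛-identityˡ (1s ⊛ 1s)) (⊛-identityˡ 1s) ⟩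
    1s ∎
    where
    open ≋-Reasoning
    exponent : (n ∸ k) * (k + 0 ∸ k) ≡ 0
    exponent = trans (cong ((n ∸ k) *_) (ℕ.m+n∸m≡n k 0)) (ℕ.*-zeroʳ (n ∸ k))
    cancel : ∀ X → qPoch k ⊛ (ρ (+ k) ⊛ X) ≋ X
    cancel X = ≋-trans (≋-sym (⊛-assoc (qPoch k) (ρ (+ k)) X))
                       (≋-trans (⊛-congˡ X (ρ-inverse k)) (⊛-identityˡ X))
    binomial : qBinom k 0 ≋ 1s
    binomial = begin
      qBinom k 0                                ≈⟨ binomial-closed 0 k ⟩
      qPoch k ⊛ (ρ (+ 0) ⊛ ρ (+ k))             ≈⟨ ⊛-congʳ (qPoch k) (⊛-comm (ρ (+ 0)) (ρ (+ k))) ⟩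
      qPoch k ⊛ (ρ (+ k) ⊛ ρ (+ 0))             ≈⟨ cancel (ρ (+ 0)) ⟩
      ρ (+ 0)                                   ≈⟨ ρ-0 ⟩
      1s                                        ∎
    multinomial : Mult 0 k k ≋ 1s
    multinomial = begin
      Mult 0 k k                                ≈⟨ Mult-closed 0 k k ⟩
      qPoch k ⊛ (ρ (+ k - + 0) ⊛ (ρ (+ k - + k) ⊛ ρ (+ (0 + k) - + k)))
        ≈⟨ ⊛-congʳ (qPoch k) (⊛-cong (ρ-sub 0 k refl)
                                      (⊛-cong (ρ-sub k 0 (ℕ.+-identityʳ k)) (ρ-sub k 0 (ℕ.+-identityʳ k)))) ⟩
      qPoch k ⊛ (ρ (+ k) ⊛ (ρ (+ 0) ⊛ ρ (+ 0))) ≈⟨ cancel (ρ (+ 0) ⊛ ρ (+ 0)) ⟩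
      ρ (+ 0) ⊛ ρ (+ 0)                         ≈⟨ ⊛-cong ρ-0 ρ-0 ⟩
      1s ⊛ 1s                                   ≈⟨ ⊛-identityˡ 1s ⟩
      1s                                        ∎

  expansion-base : ∀ n k → fnk n 0 ⊛ fnk n k ≋ Expansion n 0 k
  expansion-base n k = ≋-trans (⊛-congˡ (fnk n k) (fnk-0 n)) (≋-trans (⊛-identityˡ (fnk n k)) (by-range (k ℕ.≤? n)))
    where
    term : ℕ → Series
    term j = C n 0 k j ⊛ fnk n j
    off-diagonal : ∀ j → j ≢ k → term j ≋ 0s
    off-diagonal j j≢k = ≋-trans (⊛-congˡ (fnk n j) (C-outside n 0 k j (off-support (ℕ.<-cmp j k)))) (⊛-zeroˡ (fnk n j))
      where
      off-support : Tri (j < k) (j ≡ k) (k < j) → Outside 0 k j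
      off-support (tri< j<k _ _) = below-k j<k
      off-support (tri≈ _ j≡k _) = ⊥-elim (j≢k j≡k)
      off-support (tri> _ _ k<j) = above k<j
    by-range : Dec (k ≤ n) → fnk n k ≋ Expansion n 0 k
    by-range (yes k≤n) = ≋-sym (≋-trans (ΣS-single (suc n) k term (s≤s k≤n) λ j _ → off-diagonal j)
                                        (≋-trans (⊛-congˡ (fnk n k) (C-diagonal n k)) (⊛-identityˡ (fnk n k))))
    by-range (no k≰n) = ≋-trans (fnk-vanishes (ℕ.≰⇒> k≰n)) (≋-sym (ΣS-zero (suc n) λ j j≤n →
      off-diagonal j λ j≡k → k≰n (ℕ.≤-trans (ℕ.≤-reflexive (sym j≡k)) (ℕ.≤-pred j≤n))))

  -- q^k D(i) is cancellable: a monomial times the unit (1 - q^{i+1})².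
  cancel-qD : ∀ k i {X Y} → (qpow k ⊛ D i) ⊛ X ≋ (qpow k ⊛ D i) ⊛ Y → X ≋ Y
  cancel-qD k i {X} {Y} qDX≋qDY =
    unit-cancel (ω (suc i) ⊛ ω (suc i)) (unit-⊛ {ω (suc i)} {ω (suc i)} (constant-term refl) (constant-term refl))
      (qpow-cancel i (qpow-cancel k (≋-trans (≋-sym (regroup X)) (≋-trans qDX≋qDY (regroup Y)))))
    where
    regroup : ∀ Z → (qpow k ⊛ D i) ⊛ Z ≋ qpow k ⊛ (qpow i ⊛ ((ω (suc i) ⊛ ω (suc i)) ⊛ Z))
    regroup Z = ring 4 (λ x y w z → (x :* (y :* w)) :* z := x :* (y :* (w :* z)))
                       (qpow k ∷ qpow i ∷ ω (suc i) ⊛ ω (suc i) ∷ Z ∷ [])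

  -- The induction step i → i + 1, after multiplication by q^k D(i).
  expansion-step : ∀ n i → (∀ k → fnk n i ⊛ fnk n k ≋ Expansion n i k) →
                   ∀ k → fnk n (suc i) ⊛ fnk n k ≋ Expansion n (suc i) k
  expansion-step n i hypothesis k = cancel-qD k i (begin
    (qpow k ⊛ D i) ⊛ (fnk n (suc i) ⊛ fnk n k)
      ≈⟨ ring 4 (λ x d f′ f → (x :* d) :* (f′ :* f) := x :* ((d :* f′) :* f))
              (qpow k ∷ D i ∷ fnk n (suc i) ∷ fnk n k ∷ []) ⟩
    qpow k ⊛ ((D i ⊛ fnk n (suc i)) ⊛ fnk n k)
      ≈⟨ ⊛-congʳ (qpow k) (⊛-congˡ (fnk n k) (fnk-recurrence n i)) ⟩
    qpow k ⊛ ((E n i ⊛ fnk n i) ⊛ fnk n k)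
      ≈⟨ ring 4 (λ x e f′ f → x :* ((e :* f′) :* f) := (x :* e) :* (f′ :* f))
              (qpow k ∷ E n i ∷ fnk n i ∷ fnk n k ∷ []) ⟩
    (qpow k ⊛ E n i) ⊛ (fnk n i ⊛ fnk n k)
      ≈⟨ ⊛-congʳ (qpow k ⊛ E n i) (hypothesis k) ⟩
    (qpow k ⊛ E n i) ⊛ Expansion n i k
      ≈⟨ ΣS-⊛ (suc n) (qpow k ⊛ E n i) (λ j → C n i k j ⊛ fnk n j) ⟩
    ΣS (suc n) (λ j → (qpow k ⊛ E n i) ⊛ (C n i k j ⊛ fnk n j))
      ≈⟨ ΣS-cong (suc n) (λ j _ → split n i k j) ⟩
    ΣS (suc n) (λ j → (Raise n i k j ⊛ fnk n (suc j)) ⊕ (Stay n i k j ⊛ fnk n j))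
      ≈⟨ ΣS-⊕ (suc n) (λ j → Raise n i k j ⊛ fnk n (suc j)) (λ j → Stay n i k j ⊛ fnk n j) ⟩
    ΣS (suc n) (λ j → Raise n i k j ⊛ fnk n (suc j)) ⊕ ΣS (suc n) (λ j → Stay n i k j ⊛ fnk n j)
      ≈⟨ ⊕-congˡ (ΣS (suc n) (λ j → Stay n i k j ⊛ fnk n j))
                 (ΣS-shift (suc n) (λ j → Raise′ n i k j ⊛ fnk n j) (⊛-zeroˡ (fnk n 0))
                           (⊛-vanishes (Raise n i k n) (fnk-vanishes (ℕ.n<1+n n)))) ⟩
    ΣS (suc n) (λ j → Raise′ n i k j ⊛ fnk n j) ⊕ ΣS (suc n) (λ j → Stay n i k j ⊛ fnk n j)
      ≈⟨ ΣS-⊕ (suc n) (λ j → Raise′ n i k j ⊛ fnk n j) (λ j → Stay n i k j ⊛ fnk n j) ⟨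
    ΣS (suc n) (λ j → (Raise′ n i k j ⊛ fnk n j) ⊕ (Stay n i k j ⊛ fnk n j))
      ≈⟨ ΣS-cong (suc n) (λ j j≤n → combine j (ℕ.≤-pred j≤n)) ⟩
    ΣS (suc n) (λ j → (qpow k ⊛ D i) ⊛ (C n (suc i) k j ⊛ fnk n j))
      ≈⟨ ΣS-⊛ (suc n) (qpow k ⊛ D i) (λ j → C n (suc i) k j ⊛ fnk n j) ⟨
    (qpow k ⊛ D i) ⊛ Expansion n (suc i) k ∎)
    where
    open ≋-Reasoning
    combine : ∀ j → j ≤ n →
      (Raise′ n i k j ⊛ fnk n j) ⊕ (Stay n i k j ⊛ fnk n j) ≋ (qpow k ⊛ D i) ⊛ (C n (suc i) k j ⊛ fnk n j)
    combine j j≤n = begin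
      (Raise′ n i k j ⊛ fnk n j) ⊕ (Stay n i k j ⊛ fnk n j)
        ≈⟨ ⊛-distribʳ (fnk n j) (Raise′ n i k j) (Stay n i k j) ⟨
      (Raise′ n i k j ⊕ Stay n i k j) ⊛ fnk n j
        ≈⟨ ⊛-congˡ (fnk n j) (contiguous′ n i k j j≤n) ⟨
      ((qpow k ⊛ D i) ⊛ C n (suc i) k j) ⊛ fnk n j
        ≈⟨ ⊛-assoc (qpow k ⊛ D i) (C n (suc i) k j) (fnk n j) ⟩
      (qpow k ⊛ D i) ⊛ (C n (suc i) k j ⊛ fnk n j) ∎

  expansion : ∀ n i k → fnk n i ⊛ fnk n k ≋ Expansion n i k
  expansion n zero    = expansion-base n
  expansion n (suc i) = expansion-step n i (expansion n i)

  -- The terms with j > n vanish, so the expansion may be summed further.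
  expansion-extends : ∀ n i k M → ΣS (M + suc n) (λ j → C n i k j ⊛ fnk n j) ≋ Expansion n i k
  expansion-extends n i k M = ΣS-extend (suc n) M (λ j → C n i k j ⊛ fnk n j)
                                        (λ j n<j → ⊛-vanishes (C n i k j) (fnk-vanishes n<j))

open import Data.Nat using (ℕ; suc; _+_; _∸_)
open import Data.Integer using (+_; _-_)
open import Data.Nat.Tactic.RingSolver using (solve-∀)
open import Relation.Binary.PropositionalEquality using (_≡_; cong)
open SeriesRing using (_≋_; coeff; ≋-trans; ⊛-assoc; ⊛-congʳ; module ≋-Reasoning)
open ClosedForms using (Mult)
open Coefficients using (C)
open SeriesSums using (ΣS-cong)
open Linearization using (Expansion; expansion; expansion-extends)

mainTheorem7 : (n i k : ℕ) →
    (fnk n i ⊛ fnk n k)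
    ≈S ΣS (suc (n + i + k)) (λ j →
    qpow ((n ∸ j) Data.Nat.* (k + i ∸ j))
    ⊛ (qBinom (i + k) i
    ⊛ (qMultinom j (+ j - + i) (+ j - + k) (+ (i + k) - + j)
    ⊛ fnk n j)))
mainTheorem7 n i k = coeff (begin
  fnk n i ⊛ fnk n k                 ≈⟨ expansion n i k ⟩
  Expansion n i k                   ≈⟨ expansion-extends n i k (i + k) ⟨
  ΣS (i + k + suc n) term           ≡⟨ cong (λ N → ΣS N term) (range n i k) ⟩
  ΣS (suc (n + i + k)) term         ≈⟨ ΣS-cong (suc (n + i + k)) (λ j _ → unfold-C j) ⟩
  ΣS (suc (n + i + k)) (λ j → qpow (e j) ⊛ (qBinom (i + k) i ⊛ (Mult i k j ⊛ fnk n j))) ∎)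
  where
  open ≋-Reasoning
  e : ℕ → ℕ
  e j = (n ∸ j) Data.Nat.* (k + i ∸ j)
  term : ℕ → Series
  term j = C n i k j ⊛ fnk n j
  range : ∀ n i k → i + k + suc n ≡ suc (n + i + k)
  range = solve-∀
  unfold-C : ∀ j → term j ≋ qpow (e j) ⊛ (qBinom (i + k) i ⊛ (Mult i k j ⊛ fnk n j))
  unfold-C j = ≋-trans (⊛-assoc (qpow (e j)) (qBinom (i + k) i ⊛ Mult i k j) (fnk n j))
                       (⊛-congʳ (qpow (e j)) (⊛-assoc (qBinom (i + k) i) (Mult i k j) (fnk n j)))
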